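{- For every real $t$, as formal power series in $x$, $$\Lambda_1(t,x)=\alpha(x)^t-\alpha(x)^{ -t}=2\sinh\!\left(t\sinh^{ -1}\!\left(\tfrac{x}{2}\right)\right).$$
   Context: All series are formal power series in an indeterminate $x$ with real coefficients. For real $s$ and integer $m\ge 0$, $\binom{s}{m}=s(s-1)\cdots(s-m+1)/m!$. For real $s$ define $\Lambda_1(s,x)=\sum_{k\ge 0}\binom{(s+1)/2+k}{2k+1}\frac{s}{(s+1)/2+k}x^{2k+1}$, each coefficient being understood as the polynomial in $s$ it defines, namely $\frac{s}{2k+1}\binom{(s-1)/2+k}{2k}$ (equivalently, $\Lambda_1(2t+1,x)=\sum_{k\ge0}\binom{t+k+1}{2k+1}\frac{2t+1}{t+k+1}x^{2k+1}$ for real $t$). Let $\sqrt{x^2+4}$ denote the formal power series $2\sum_{m\ge0}\binom{1/2}{m}(x^2/4)^m$, and let $\alpha(x)=\frac{x+\sqrt{x^2+4}}{2}$, a series with constant term $1$. For real $t$, $\alpha(x)^t:=\exp(t\log\alpha(x))$ as formal power series; equivalently $\alpha(x)^t=e^{t\sinh^{ -1}(x/2)}$, where $\sinh(y)=(e^y-e^{ -y})/2$ and $\sinh^{ -1}$ is its compositional inverse as a formal power series. -}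

module Defs where

open import Level using (Level)
open import Data.Nat using (ℕ; zero; suc; _∸_)
open import Data.Product using (_×_)
open import Algebra.Bundles using (CommutativeRing)

-- Formal power series over a commutative ring R in which every positive
-- integer is invertible (a Q-algebra; e.g. the real numbers).
-- `inv n` is the inverse of the integer n (for n ≥ 1; inv 0 is never used).
module PS {c ℓ : Level} (R : CommutativeRing c ℓ) (inv : ℕ → CommutativeRing.Carrier R) where
  open CommutativeRing R

  nat : ℕ → Carrier
  nat zero = 0#
  nat (suc n) = 1# + nat n

  InvSpec : Set ℓ
  InvSpec = ∀ n → nat (suc n) * inv (suc n) ≈ 1#

  Σ< : ℕ → (ℕ → Carrier) → Carrier
  Σ< zero f = 0#
  Σ< (suc n) f = Σ< n f + f n

  Π< : ℕ → (ℕ → Carrier) → Carrier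
  Π< zero f = 1#
  Π< (suc n) f = Π< n f * f n

  _^_ : Carrier → ℕ → Carrier
  a ^ n = Π< n (λ _ → a)

  invFact : ℕ → Carrier
  invFact m = Π< m (λ j → inv (suc j))

  binom : Carrier → ℕ → Carrier
  binom s m = Π< m (λ j → s - nat j) * invFact m

  half : Carrier
  half = inv 2

  Series : Set c
  Series = ℕ → Carrier

  _≋_ : Series → Series → Set ℓ
  f ≋ g = ∀ n → f n ≈ g n

  -- series supported on odd / even exponents:
  -- oddPart g has coefficient g k at x^(2k+1), evenPart g has g k at x^(2k)
  oddPart : (ℕ → Carrier) → Series
  oddPart g zero = 0#
  oddPart g (suc zero) = g 0
  oddPart g (suc (suc n)) = oddPart (λ k → g (suc k)) n

  evenPart : (ℕ → Carrier) → Series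
  evenPart g zero = g 0
  evenPart g (suc zero) = 0#
  evenPart g (suc (suc n)) = evenPart (λ k → g (suc k)) n

  oneS : Series
  oneS zero = 1#
  oneS (suc n) = 0#

  X : Series
  X (suc zero) = 1#
  X _ = 0#

  _⊕_ : Series → Series → Series
  (f ⊕ g) n = f n + g n

  _⊖_ : Series → Series → Series
  (f ⊖ g) n = f n - g n

  scale : Carrier → Series → Series
  scale a f n = a * f n

  _⊛_ : Series → Series → Series
  (f ⊛ g) n = Σ< (suc n) (λ i → f i * g (n ∸ i))

  pow : Series → ℕ → Series
  pow f zero = oneS
  pow f (suc m) = f ⊛ pow f m

  -- composition f(h(x)) (meaningful when h has zero constant term)
  comp : Series → Series → Series
  comp f h n = Σ< (suc n) (λ m → f m * pow h m n)

  expS : Series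
  expS n = invFact n

  log1pS : Series
  log1pS zero = 0#
  log1pS (suc n) = ((- 1#) ^ n) * inv (suc n)

  sinhS : Series
  sinhS = oddPart (λ k → invFact (suc (k Data.Nat.+ k)))

  Λ₁ : Carrier → Series
  Λ₁ s = oddPart (λ k → s * inv (suc (k Data.Nat.+ k))
                          * binom ((s - 1#) * half + nat k) (k Data.Nat.+ k))

  -- sqrt(x^2+4) = 2 Σ binom(1/2,m) (x^2/4)^m
  sqrtS : Series
  sqrtS = evenPart (λ m → nat 2 * (binom half m * (inv 4 ^ m)))

  α : Series
  α = scale half (X ⊕ sqrtS)

  logα : Series
  logα = comp log1pS (α ⊖ oneS)

  αpow : Carrier → Series
  αpow t = comp expS (scale t logα)

  IsAsinh : Series → Set ℓ
  IsAsinh g = (g 0 ≈ 0#) × (comp sinhS g ≋ X) × (comp g sinhS ≋ X)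

-- Both sides of each identity satisfy (x² + 4) F″ + x F′ = t² F.  Indeed F = Φ(t G) does whenever
-- Φ″ = Φ, G(0) = 0 and (x² + 4) G′² = 1, and both G = log α (as √(x² + 4) · (log α)′ = 1) and
-- G(x) = sinh⁻¹(x/2) (as cosh(sinh⁻¹ y)² = 1 + y²) have this property.  On coefficients the
-- equation reads 4 (n+1) (n+2) F(n+2) = (t² − n²) F(n), which Λ₁ satisfies by a direct binomial
-- computation, and such an F is determined by F(0) = 0 and F(1) = t.

module Submission where

open import Defs
open import Level using (Level; 0ℓ)
open import Algebra.Bundles using (CommutativeRing; RawRing)
open import Algebra.Solver.Ring.AlmostCommutativeRing using (_-Raw-AlmostCommutative⟶_; fromCommutativeRing)
open import Data.Maybe as Maybe using (Maybe; nothing)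
open import Data.Nat as ℕ using (ℕ; zero; suc; _∸_; z≤n; s≤s)
import Data.Nat.Properties as ℕ
open import Data.Product using (_×_; _,_; proj₁; proj₂)
open import Data.Sum using (inj₁; inj₂)
open import Relation.Binary.PropositionalEquality as ≡ using (_≡_)
open import Relation.Binary.Structures using (IsEquivalence)
open import Relation.Nullary.Decidable using (dec⇒maybe)

-- Integer coefficients for Algebra.Solver.Ring, kept in normal form so that equal normal
-- forms of polynomials are syntactically equal.
data Coeff : Set where
  pos    : ℕ → Coeff
  negsuc : ℕ → Coeff

_⊖ᶜ_ : ℕ → ℕ → Coeff
m     ⊖ᶜ zero  = pos m
zero  ⊖ᶜ suc n = negsuc n
suc m ⊖ᶜ suc n = m ⊖ᶜ n

positivePart negativePart : Coeff → ℕ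
positivePart (pos n)    = n
positivePart (negsuc n) = 0
negativePart (pos n)    = 0
negativePart (negsuc n) = suc n

coeffRawRing : RawRing 0ℓ 0ℓ
coeffRawRing = record
  { Carrier = Coeff
  ; _≈_     = _≡_
  ; _+_     = λ x y → (positivePart x ℕ.+ positivePart y) ⊖ᶜ (negativePart x ℕ.+ negativePart y)
  ; _*_     = λ x y → (positivePart x ℕ.* positivePart y ℕ.+ negativePart x ℕ.* negativePart y)
                   ⊖ᶜ (positivePart x ℕ.* negativePart y ℕ.+ negativePart x ℕ.* positivePart y)
  ; -_      = λ x → negativePart x ⊖ᶜ positivePart x
  ; 0#      = pos 0
  ; 1#      = pos 1
  }

coeff-≟ : (x y : Coeff) → Maybe (x ≡ y)
coeff-≟ (pos m)    (pos n)    = Maybe.map (≡.cong pos) (dec⇒maybe (m ℕ.≟ n))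
coeff-≟ (negsuc m) (negsuc n) = Maybe.map (≡.cong negsuc) (dec⇒maybe (m ℕ.≟ n))
coeff-≟ _          _          = nothing

module CommutativeRingSolver {c ℓ : Level} (R : CommutativeRing c ℓ) where
  open CommutativeRing R
  open import Algebra.Properties.Ring ring using (-‿+-comm; -‿involutive; [y-z]x≈yx-zx; x[y-z]≈xy-xz)
  open import Algebra.Properties.CommutativeSemigroup +-commutativeSemigroup using (interchange)
  open import Relation.Binary.Reasoning.Setoid setoid
  open RawRing coeffRawRing using () renaming (_+_ to _+ᶜ_; _*_ to _*ᶜ_; -_ to -ᶜ_)

  natᴿ : ℕ → Carrier
  natᴿ zero    = 0#
  natᴿ (suc n) = 1# + natᴿ n

  natᴿ-+ : ∀ m n → natᴿ (m ℕ.+ n) ≈ natᴿ m + natᴿ n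
  natᴿ-+ zero    n = sym (+-identityˡ _)
  natᴿ-+ (suc m) n = trans (+-congˡ (natᴿ-+ m n)) (sym (+-assoc _ _ _))

  natᴿ-* : ∀ m n → natᴿ (m ℕ.* n) ≈ natᴿ m * natᴿ n
  natᴿ-* zero    n = sym (zeroˡ _)
  natᴿ-* (suc m) n = begin
    natᴿ (n ℕ.+ m ℕ.* n)             ≈⟨ natᴿ-+ n (m ℕ.* n) ⟩
    natᴿ n + natᴿ (m ℕ.* n)          ≈⟨ +-cong (sym (*-identityˡ _)) (natᴿ-* m n) ⟩
    1# * natᴿ n + natᴿ m * natᴿ n    ≈⟨ distribʳ _ _ _ ⟨
    natᴿ (suc m) * natᴿ n            ∎

  -- fromℕ 1 is 1# and, for k ≥ 2, fromℕ k reduces to the same term as PS.nat k, so that the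
  -- solver's constants match both notations occurring in goals.
  fromℕ : ℕ → Carrier
  fromℕ zero          = 0#
  fromℕ (suc zero)    = 1#
  fromℕ (suc (suc n)) = 1# + natᴿ (suc n)

  fromℕ≈natᴿ : ∀ n → fromℕ n ≈ natᴿ n
  fromℕ≈natᴿ zero          = refl
  fromℕ≈natᴿ (suc zero)    = sym (+-identityʳ 1#)
  fromℕ≈natᴿ (suc (suc n)) = refl

  ⟦_⟧ᶜ : Coeff → Carrier
  ⟦ pos n    ⟧ᶜ = fromℕ n
  ⟦ negsuc n ⟧ᶜ = - natᴿ (suc n)

  x-0≈x : ∀ x → x - 0# ≈ x
  x-0≈x x = trans (+-congˡ (trans (sym (+-identityˡ (- 0#))) (-‿inverseʳ 0#))) (+-identityʳ x)

  ⟦⊖ᶜ⟧ : ∀ m n → ⟦ m ⊖ᶜ n ⟧ᶜ ≈ natᴿ m - natᴿ n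
  ⟦⊖ᶜ⟧ m       zero    = trans (fromℕ≈natᴿ m) (sym (x-0≈x _))
  ⟦⊖ᶜ⟧ zero    (suc n) = sym (+-identityˡ _)
  ⟦⊖ᶜ⟧ (suc m) (suc n) = begin
    ⟦ m ⊖ᶜ n ⟧ᶜ                      ≈⟨ ⟦⊖ᶜ⟧ m n ⟩
    natᴿ m - natᴿ n                  ≈⟨ +-identityˡ _ ⟨
    0# + (natᴿ m - natᴿ n)           ≈⟨ +-congʳ (-‿inverseʳ 1#) ⟨
    (1# - 1#) + (natᴿ m - natᴿ n)    ≈⟨ interchange _ _ _ _ ⟩
    natᴿ (suc m) + (- 1# - natᴿ n)   ≈⟨ +-congˡ (-‿+-comm 1# (natᴿ n)) ⟩
    natᴿ (suc m) - natᴿ (suc n)      ∎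

  ⟦⟧ᶜ≈parts : ∀ x → ⟦ x ⟧ᶜ ≈ natᴿ (positivePart x) - natᴿ (negativePart x)
  ⟦⟧ᶜ≈parts (pos n)    = trans (fromℕ≈natᴿ n) (sym (x-0≈x _))
  ⟦⟧ᶜ≈parts (negsuc n) = sym (+-identityˡ _)

  private
    differences-+ : ∀ a b a' b' → (a + a') - (b + b') ≈ (a - b) + (a' - b')
    differences-+ a b a' b' = trans (+-congˡ (sym (-‿+-comm b b'))) (interchange _ _ _ _)

    differences-* : ∀ a b a' b' → (a * a' + b * b') - (a * b' + b * a') ≈ (a - b) * (a' - b')
    differences-* a b a' b' = sym (begin
      (a - b) * (a' - b')                            ≈⟨ [y-z]x≈yx-zx _ _ _ ⟩
      a * (a' - b') - b * (a' - b')                  ≈⟨ +-cong (x[y-z]≈xy-xz _ _ _) (-‿cong (x[y-z]≈xy-xz _ _ _)) ⟩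
      (a * a' - a * b') - (b * a' - b * b')          ≈⟨ +-congˡ (-‿+-comm _ _) ⟨
      (a * a' - a * b') + (- (b * a') - - (b * b'))  ≈⟨ +-congˡ (+-congˡ (-‿involutive _)) ⟩
      (a * a' - a * b') + (- (b * a') + b * b')      ≈⟨ +-congˡ (+-comm _ _) ⟩
      (a * a' - a * b') + (b * b' - b * a')          ≈⟨ interchange _ _ _ _ ⟩
      (a * a' + b * b') + (- (a * b') - b * a')      ≈⟨ +-congˡ (-‿+-comm _ _) ⟩
      (a * a' + b * b') - (a * b' + b * a')          ∎)

    differences-swap : ∀ a b → b - a ≈ - (a - b)
    differences-swap a b = begin
      b - a         ≈⟨ +-comm _ _ ⟩
      - a + b       ≈⟨ +-congˡ (-‿involutive b) ⟨
      - a + - - b   ≈⟨ -‿+-comm _ _ ⟩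
      - (a - b)     ∎

  coeffHomomorphism : coeffRawRing -Raw-AlmostCommutative⟶ fromCommutativeRing R
  coeffHomomorphism = record
    { ⟦_⟧    = ⟦_⟧ᶜ
    ; +-homo = λ x y → begin
        ⟦ x +ᶜ y ⟧ᶜ
          ≈⟨ ⟦⊖ᶜ⟧ (p⁺ x ℕ.+ p⁺ y) (p⁻ x ℕ.+ p⁻ y) ⟩
        natᴿ (p⁺ x ℕ.+ p⁺ y) - natᴿ (p⁻ x ℕ.+ p⁻ y)
          ≈⟨ +-cong (natᴿ-+ (p⁺ x) (p⁺ y)) (-‿cong (natᴿ-+ (p⁻ x) (p⁻ y))) ⟩
        (natᴿ (p⁺ x) + natᴿ (p⁺ y)) - (natᴿ (p⁻ x) + natᴿ (p⁻ y))
          ≈⟨ differences-+ _ _ _ _ ⟩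
        (natᴿ (p⁺ x) - natᴿ (p⁻ x)) + (natᴿ (p⁺ y) - natᴿ (p⁻ y))
          ≈⟨ +-cong (⟦⟧ᶜ≈parts x) (⟦⟧ᶜ≈parts y) ⟨
        ⟦ x ⟧ᶜ + ⟦ y ⟧ᶜ ∎
    ; *-homo = λ x y → begin
        ⟦ x *ᶜ y ⟧ᶜ
          ≈⟨ ⟦⊖ᶜ⟧ (p⁺ x ℕ.* p⁺ y ℕ.+ p⁻ x ℕ.* p⁻ y) (p⁺ x ℕ.* p⁻ y ℕ.+ p⁻ x ℕ.* p⁺ y) ⟩
        natᴿ (p⁺ x ℕ.* p⁺ y ℕ.+ p⁻ x ℕ.* p⁻ y) - natᴿ (p⁺ x ℕ.* p⁻ y ℕ.+ p⁻ x ℕ.* p⁺ y)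
          ≈⟨ +-cong (natᴿ-+* (p⁺ x) (p⁺ y) (p⁻ x) (p⁻ y)) (-‿cong (natᴿ-+* (p⁺ x) (p⁻ y) (p⁻ x) (p⁺ y))) ⟩
        (natᴿ (p⁺ x) * natᴿ (p⁺ y) + natᴿ (p⁻ x) * natᴿ (p⁻ y))
          - (natᴿ (p⁺ x) * natᴿ (p⁻ y) + natᴿ (p⁻ x) * natᴿ (p⁺ y))
          ≈⟨ differences-* _ _ _ _ ⟩
        (natᴿ (p⁺ x) - natᴿ (p⁻ x)) * (natᴿ (p⁺ y) - natᴿ (p⁻ y))
          ≈⟨ *-cong (⟦⟧ᶜ≈parts x) (⟦⟧ᶜ≈parts y) ⟨
        ⟦ x ⟧ᶜ * ⟦ y ⟧ᶜ ∎
    ; -‿homo = λ x → begin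
        ⟦ -ᶜ x ⟧ᶜ                          ≈⟨ ⟦⊖ᶜ⟧ (p⁻ x) (p⁺ x) ⟩
        natᴿ (p⁻ x) - natᴿ (p⁺ x)          ≈⟨ differences-swap _ _ ⟩
        - (natᴿ (p⁺ x) - natᴿ (p⁻ x))      ≈⟨ -‿cong (⟦⟧ᶜ≈parts x) ⟨
        - ⟦ x ⟧ᶜ                           ∎
    ; 0-homo = refl
    ; 1-homo = refl
    }
    where
    p⁺ p⁻ : Coeff → ℕ
    p⁺ = positivePart
    p⁻ = negativePart
    natᴿ-+* : ∀ i j k l → natᴿ (i ℕ.* j ℕ.+ k ℕ.* l) ≈ natᴿ i * natᴿ j + natᴿ k * natᴿ l
    natᴿ-+* i j k l = trans (natᴿ-+ (i ℕ.* j) (k ℕ.* l)) (+-cong (natᴿ-* i j) (natᴿ-* k l))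

  private
    coeffEquality : ∀ x y → Maybe (⟦ x ⟧ᶜ ≈ ⟦ y ⟧ᶜ)
    coeffEquality x y = Maybe.map (λ e → reflexive (≡.cong ⟦_⟧ᶜ e)) (coeff-≟ x y)

  open import Algebra.Solver.Ring coeffRawRing (fromCommutativeRing R) coeffHomomorphism coeffEquality public

  # : ∀ {n} → ℕ → Polynomial n
  # k = con (pos k)

module Sums {c ℓ : Level} (R : CommutativeRing c ℓ) (inv : ℕ → CommutativeRing.Carrier R) where
  open CommutativeRing R
  open PS R inv
  open import Algebra.Properties.CommutativeSemigroup +-commutativeSemigroup using (interchange)
  open import Relation.Binary.Reasoning.Setoid setoid

  Σ<-cong : ∀ n {f g : ℕ → Carrier} → (∀ i → i ℕ.< n → f i ≈ g i) → Σ< n f ≈ Σ< n g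
  Σ<-cong zero    f≈g = refl
  Σ<-cong (suc n) f≈g = +-cong (Σ<-cong n (λ i i<n → f≈g i (ℕ.m<n⇒m<1+n i<n))) (f≈g n ℕ.≤-refl)

  Σ<-cong′ : ∀ n {f g : ℕ → Carrier} → (∀ i → f i ≈ g i) → Σ< n f ≈ Σ< n g
  Σ<-cong′ n f≈g = Σ<-cong n (λ i _ → f≈g i)

  Σ<-distrib-+ : ∀ n (f g : ℕ → Carrier) → Σ< n (λ i → f i + g i) ≈ Σ< n f + Σ< n g
  Σ<-distrib-+ zero    f g = sym (+-identityˡ 0#)
  Σ<-distrib-+ (suc n) f g = trans (+-congʳ (Σ<-distrib-+ n f g)) (interchange _ _ _ _)

  Σ<-*ˡ : ∀ n (a : Carrier) (f : ℕ → Carrier) → Σ< n (λ i → a * f i) ≈ a * Σ< n f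
  Σ<-*ˡ zero    a f = sym (zeroʳ a)
  Σ<-*ˡ (suc n) a f = trans (+-congʳ (Σ<-*ˡ n a f)) (sym (distribˡ _ _ _))

  Σ<-*ʳ : ∀ n (a : Carrier) (f : ℕ → Carrier) → Σ< n (λ i → f i * a) ≈ Σ< n f * a
  Σ<-*ʳ zero    a f = sym (zeroˡ a)
  Σ<-*ʳ (suc n) a f = trans (+-congʳ (Σ<-*ʳ n a f)) (sym (distribʳ _ _ _))

  Σ<-zero : ∀ n (f : ℕ → Carrier) → (∀ i → i ℕ.< n → f i ≈ 0#) → Σ< n f ≈ 0#
  Σ<-zero zero    f f≈0 = refl
  Σ<-zero (suc n) f f≈0 =
    trans (+-cong (Σ<-zero n f (λ i i<n → f≈0 i (ℕ.m<n⇒m<1+n i<n))) (f≈0 n ℕ.≤-refl)) (+-identityʳ 0#)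

  Σ<-first : ∀ n (f : ℕ → Carrier) → Σ< (suc n) f ≈ f 0 + Σ< n (λ i → f (suc i))
  Σ<-first zero    f = trans (+-identityˡ _) (sym (+-identityʳ _))
  Σ<-first (suc n) f = trans (+-congʳ (Σ<-first n f)) (+-assoc _ _ _)

  Σ<-swap : ∀ n m (f : ℕ → ℕ → Carrier) → Σ< n (λ i → Σ< m (f i)) ≈ Σ< m (λ j → Σ< n (λ i → f i j))
  Σ<-swap zero    m f = sym (Σ<-zero m _ (λ _ _ → refl))
  Σ<-swap (suc n) m f = trans (+-congʳ (Σ<-swap n m f)) (sym (Σ<-distrib-+ m _ _))

  Σ<-reverse : ∀ n (f : ℕ → Carrier) → Σ< (suc n) f ≈ Σ< (suc n) (λ i → f (n ∸ i))
  Σ<-reverse zero    f = refl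
  Σ<-reverse (suc n) f = begin
    Σ< (suc n) f + f (suc n)                       ≈⟨ +-congʳ (Σ<-reverse n f) ⟩
    Σ< (suc n) (λ i → f (n ∸ i)) + f (suc n)       ≈⟨ +-comm _ _ ⟩
    f (suc n) + Σ< (suc n) (λ i → f (n ∸ i))       ≈⟨ Σ<-first (suc n) (λ i → f (suc n ∸ i)) ⟨
    Σ< (suc (suc n)) (λ i → f (suc n ∸ i))         ∎

  Π<-first : ∀ n (f : ℕ → Carrier) → Π< (suc n) f ≈ f 0 * Π< n (λ i → f (suc i))
  Π<-first zero    f = trans (*-identityˡ _) (sym (*-identityʳ _))
  Π<-first (suc n) f = trans (*-congʳ (Π<-first n f)) (*-assoc _ _ _)

  Π<-cong : ∀ n {f g : ℕ → Carrier} → (∀ i → f i ≈ g i) → Π< n f ≈ Π< n g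
  Π<-cong zero    f≈g = refl
  Π<-cong (suc n) f≈g = *-cong (Π<-cong n f≈g) (f≈g n)

module SeriesRing {c ℓ : Level} (R : CommutativeRing c ℓ) (inv : ℕ → CommutativeRing.Carrier R) where
  open CommutativeRing R
  open PS R inv
  open Sums R inv
  open CommutativeRingSolver R using (solve; _:=_; _:+_; _:*_)
  import Relation.Binary.Reasoning.Setoid
  open Relation.Binary.Reasoning.Setoid setoid

  negS : Series → Series
  negS f n = - f n

  zeroS : Series
  zeroS n = 0#

  shift : Series → Series
  shift f n = f (suc n)

  ⊛-suc : ∀ f g n → (f ⊛ g) (suc n) ≈ f 0 * g (suc n) + (shift f ⊛ g) n
  ⊛-suc f g n = Σ<-first (suc n) (λ i → f i * g (suc n ∸ i))

  ⊛-zero : ∀ f g → (f ⊛ g) 0 ≈ f 0 * g 0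
  ⊛-zero f g = +-identityˡ _

  ⊛-cong : ∀ {f f′ g g′} → f ≋ f′ → g ≋ g′ → (f ⊛ g) ≋ (f′ ⊛ g′)
  ⊛-cong f≋f′ g≋g′ n = Σ<-cong′ (suc n) (λ i → *-cong (f≋f′ i) (g≋g′ (n ∸ i)))

  ⊛-distribˡ : ∀ f g h → (f ⊛ (g ⊕ h)) ≋ ((f ⊛ g) ⊕ (f ⊛ h))
  ⊛-distribˡ f g h n = trans (Σ<-cong′ (suc n) (λ i → distribˡ _ _ _)) (Σ<-distrib-+ (suc n) _ _)

  ⊛-distribʳ : ∀ f g h → ((g ⊕ h) ⊛ f) ≋ ((g ⊛ f) ⊕ (h ⊛ f))
  ⊛-distribʳ f g h n = trans (Σ<-cong′ (suc n) (λ i → distribʳ _ _ _)) (Σ<-distrib-+ (suc n) _ _)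

  ⊛-comm : ∀ f g → (f ⊛ g) ≋ (g ⊛ f)
  ⊛-comm f g n = begin
    Σ< (suc n) (λ i → f i * g (n ∸ i))                   ≈⟨ Σ<-reverse n _ ⟩
    Σ< (suc n) (λ i → f (n ∸ i) * g (n ∸ (n ∸ i)))       ≈⟨ Σ<-cong (suc n) (λ i i≤n → trans (*-comm _ _)
                                                              (reflexive (≡.cong (λ k → g k * f (n ∸ i)) (ℕ.m∸[m∸n]≡n (ℕ.≤-pred i≤n))))) ⟩
    Σ< (suc n) (λ i → g i * f (n ∸ i))                   ∎

  oneS-⊛ : ∀ f → (oneS ⊛ f) ≋ f
  oneS-⊛ f n = begin
    Σ< (suc n) (λ i → oneS i * f (n ∸ i))                ≈⟨ Σ<-first n _ ⟩
    1# * f n + Σ< n (λ i → 0# * f (n ∸ suc i))           ≈⟨ +-cong (*-identityˡ _) (Σ<-zero n _ (λ i _ → zeroˡ _)) ⟩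
    f n + 0#                                             ≈⟨ +-identityʳ _ ⟩
    f n                                                  ∎

  ⊛-oneS : ∀ f → (f ⊛ oneS) ≋ f
  ⊛-oneS f n = trans (⊛-comm f oneS n) (oneS-⊛ f n)

  scale-⊛ : ∀ a f g → (scale a f ⊛ g) ≋ scale a (f ⊛ g)
  scale-⊛ a f g n = trans (Σ<-cong′ (suc n) (λ i → *-assoc _ _ _)) (Σ<-*ˡ (suc n) a _)

  ⊛-assoc : ∀ f g h → ((f ⊛ g) ⊛ h) ≋ (f ⊛ (g ⊛ h))
  ⊛-assoc f g h zero = begin
    ((f ⊛ g) ⊛ h) 0        ≈⟨ trans (⊛-zero (f ⊛ g) h) (*-congʳ (⊛-zero f g)) ⟩
    (f 0 * g 0) * h 0      ≈⟨ *-assoc _ _ _ ⟩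
    f 0 * (g 0 * h 0)      ≈⟨ trans (⊛-zero f (g ⊛ h)) (*-congˡ (⊛-zero g h)) ⟨
    (f ⊛ (g ⊛ h)) 0        ∎
  ⊛-assoc f g h (suc n) = begin
    ((f ⊛ g) ⊛ h) (suc n)
      ≈⟨ ⊛-suc (f ⊛ g) h n ⟩
    (f ⊛ g) 0 * h (suc n) + (shift (f ⊛ g) ⊛ h) n
      ≈⟨ +-cong (*-congʳ (⊛-zero f g)) (⊛-cong {g = h} shift-⊛ (λ _ → refl) n) ⟩
    (f 0 * g 0) * h (suc n) + (((shift f ⊛ g) ⊕ scale (f 0) (shift g)) ⊛ h) n
      ≈⟨ +-congˡ (trans (⊛-distribʳ h _ _ n) (+-cong (⊛-assoc (shift f) g h n) (scale-⊛ (f 0) (shift g) h n))) ⟩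
    (f 0 * g 0) * h (suc n) + ((shift f ⊛ (g ⊛ h)) n + f 0 * (shift g ⊛ h) n)
      ≈⟨ solve 5 (λ a b c d e → (a :* b) :* c :+ (d :+ a :* e) := a :* (b :* c :+ e) :+ d) refl _ _ _ _ _ ⟩
    f 0 * (g 0 * h (suc n) + (shift g ⊛ h) n) + (shift f ⊛ (g ⊛ h)) n
      ≈⟨ +-congʳ (*-congˡ (⊛-suc g h n)) ⟨
    f 0 * (g ⊛ h) (suc n) + (shift f ⊛ (g ⊛ h)) n
      ≈⟨ ⊛-suc f (g ⊛ h) n ⟨
    (f ⊛ (g ⊛ h)) (suc n) ∎
    where
    shift-⊛ : shift (f ⊛ g) ≋ ((shift f ⊛ g) ⊕ scale (f 0) (shift g))
    shift-⊛ n = trans (⊛-suc f g n) (+-comm _ _)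

  ≋-isEquivalence : IsEquivalence _≋_
  ≋-isEquivalence = record
    { refl  = λ _ → refl
    ; sym   = λ f≋g n → sym (f≋g n)
    ; trans = λ f≋g g≋h n → trans (f≋g n) (g≋h n)
    }

  seriesRing : CommutativeRing c ℓ
  seriesRing = record
    { Carrier = Series ; _≈_ = _≋_ ; _+_ = _⊕_ ; _*_ = _⊛_ ; -_ = negS ; 0# = zeroS ; 1# = oneS
    ; isCommutativeRing = record
      { isRing = record
        { +-isAbelianGroup = record
          { isGroup = record
            { isMonoid = record
              { isSemigroup = record
                { isMagma = record { isEquivalence = ≋-isEquivalence ; ∙-cong = λ f≋ g≋ n → +-cong (f≋ n) (g≋ n) }
                ; assoc = λ f g h n → +-assoc _ _ _ }
              ; identity = (λ f n → +-identityˡ _) , (λ f n → +-identityʳ _) }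
            ; inverse = (λ f n → -‿inverseˡ _) , (λ f n → -‿inverseʳ _)
            ; ⁻¹-cong = λ f≋g n → -‿cong (f≋g n) }
          ; comm = λ f g n → +-comm _ _ }
        ; *-cong = ⊛-cong
        ; *-assoc = ⊛-assoc
        ; *-identity = oneS-⊛ , ⊛-oneS
        ; distrib = ⊛-distribˡ , ⊛-distribʳ }
      ; *-comm = ⊛-comm } }

  module ≈-Reasoning = Relation.Binary.Reasoning.Setoid setoid
  module ≋-Reasoning = Relation.Binary.Reasoning.Setoid (CommutativeRing.setoid seriesRing)

  open CommutativeRing seriesRing public
    using () renaming (refl to ≋-refl; sym to ≋-sym; trans to ≋-trans; +-cong to ⊕-cong)

  ⊕-comm : ∀ f g → (f ⊕ g) ≋ (g ⊕ f)
  ⊕-comm f g n = +-comm (f n) (g n)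

  ⊛-congˡ : ∀ f {g g′} → g ≋ g′ → (f ⊛ g) ≋ (f ⊛ g′)
  ⊛-congˡ f g≋g′ = ⊛-cong {f = f} (λ _ → refl) g≋g′

  ⊛-congʳ : ∀ g {f f′} → f ≋ f′ → (f ⊛ g) ≋ (f′ ⊛ g)
  ⊛-congʳ g f≋f′ = ⊛-cong {g = g} f≋f′ (λ _ → refl)

module Calculus {c ℓ : Level} (R : CommutativeRing c ℓ) (inv : ℕ → CommutativeRing.Carrier R)
                (invSpec : PS.InvSpec R inv) where
  open CommutativeRing R
  open PS R inv
  open Sums R inv
  open SeriesRing R inv
  open import Data.Nat.Induction using (<-rec)
  open CommutativeRingSolver R using (solve; _:=_; _:+_; _:*_; :-_; _:-_)
  module SS = CommutativeRingSolver seriesRing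

  constS : Carrier → Series
  constS a = scale a oneS

  ∂ : Series → Series
  ∂ f n = nat (suc n) * f (suc n)

  θ : Series → Series
  θ f n = nat n * f n

  nat-+ : ∀ m n → nat (m ℕ.+ n) ≈ nat m + nat n
  nat-+ zero    n = sym (+-identityˡ _)
  nat-+ (suc m) n = trans (+-congˡ (nat-+ m n)) (sym (+-assoc _ _ _))

  nat-*-cancelˡ : ∀ k {x y} → nat (suc k) * x ≈ nat (suc k) * y → x ≈ y
  nat-*-cancelˡ k {x} {y} kx≈ky = begin
    x                              ≈⟨ *-identityʳ x ⟨
    x * 1#                         ≈⟨ *-congˡ (invSpec k) ⟨
    x * (nat (suc k) * inv (suc k)) ≈⟨ *-assoc _ _ _ ⟨
    x * nat (suc k) * inv (suc k)   ≈⟨ *-congʳ (trans (*-comm _ _) (trans kx≈ky (*-comm _ _))) ⟩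
    y * nat (suc k) * inv (suc k)   ≈⟨ *-assoc _ _ _ ⟩
    y * (nat (suc k) * inv (suc k)) ≈⟨ *-congˡ (invSpec k) ⟩
    y * 1#                         ≈⟨ *-identityʳ y ⟩
    y                              ∎
    where open ≈-Reasoning

  nat-*-zero : ∀ k {x} → nat (suc k) * x ≈ 0# → x ≈ 0#
  nat-*-zero k kx≈0 = nat-*-cancelˡ k (trans kx≈0 (sym (zeroʳ _)))

  X⊛-zero : ∀ f → (X ⊛ f) 0 ≈ 0#
  X⊛-zero f = trans (⊛-zero X f) (zeroˡ _)

  X⊛-suc : ∀ f n → (X ⊛ f) (suc n) ≈ f n
  X⊛-suc f n = begin
    (X ⊛ f) (suc n)                 ≈⟨ ⊛-suc X f n ⟩
    0# * f (suc n) + (shift X ⊛ f) n ≈⟨ +-cong (zeroˡ _) (⊛-congʳ f shift-X n) ⟩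
    0# + (oneS ⊛ f) n               ≈⟨ trans (+-identityˡ _) (oneS-⊛ f n) ⟩
    f n                             ∎
    where
    open ≈-Reasoning
    shift-X : shift X ≋ oneS
    shift-X zero    = refl
    shift-X (suc n) = refl

  X⊛-cancelˡ : ∀ {f g} → (X ⊛ f) ≋ (X ⊛ g) → f ≋ g
  X⊛-cancelˡ {f} {g} Xf≋Xg n = trans (sym (X⊛-suc f n)) (trans (Xf≋Xg (suc n)) (X⊛-suc g n))

  scale≋constS⊛ : ∀ a f → scale a f ≋ (constS a ⊛ f)
  scale≋constS⊛ a f n = sym (trans (scale-⊛ a oneS f n) (*-congˡ (oneS-⊛ f n)))

  constS-1# : constS 1# ≋ oneS
  constS-1# n = *-identityˡ _

  constS-cong : ∀ {a b} → a ≈ b → constS a ≋ constS b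
  constS-cong a≈b n = *-congʳ a≈b

  constS-* : ∀ a b → constS (a * b) ≋ (constS a ⊛ constS b)
  constS-* a b n = trans (*-assoc _ _ _) (scale≋constS⊛ a (constS b) n)

  constS-+ : ∀ a b → constS (a + b) ≋ (constS a ⊕ constS b)
  constS-+ a b n = distribʳ _ _ _

  θ≋X⊛∂ : ∀ f → θ f ≋ (X ⊛ ∂ f)
  θ≋X⊛∂ f zero    = trans (zeroˡ _) (sym (X⊛-zero (∂ f)))
  θ≋X⊛∂ f (suc n) = sym (X⊛-suc (∂ f) n)

  θ-⊛ : ∀ f g → θ (f ⊛ g) ≋ ((θ f ⊛ g) ⊕ (f ⊛ θ g))
  θ-⊛ f g n = begin
    nat n * Σ< (suc n) (λ i → f i * g (n ∸ i))
      ≈⟨ Σ<-*ˡ (suc n) (nat n) _ ⟨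
    Σ< (suc n) (λ i → nat n * (f i * g (n ∸ i)))
      ≈⟨ Σ<-cong (suc n) (λ i i<1+n → leibniz i (ℕ.≤-pred i<1+n)) ⟩
    Σ< (suc n) (λ i → (nat i * f i) * g (n ∸ i) + f i * (nat (n ∸ i) * g (n ∸ i)))
      ≈⟨ Σ<-distrib-+ (suc n) _ _ ⟩
    ((θ f ⊛ g) ⊕ (f ⊛ θ g)) n ∎
    where
    open ≈-Reasoning
    leibniz : ∀ i → i ℕ.≤ n → nat n * (f i * g (n ∸ i)) ≈ (nat i * f i) * g (n ∸ i) + f i * (nat (n ∸ i) * g (n ∸ i))
    leibniz i i≤n = begin
      nat n * (f i * g (n ∸ i))
        ≈⟨ *-congʳ (trans (reflexive (≡.cong nat (≡.sym (ℕ.m+[n∸m]≡n i≤n)))) (nat-+ i (n ∸ i))) ⟩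
      (nat i + nat (n ∸ i)) * (f i * g (n ∸ i))
        ≈⟨ solve 4 (λ a b x y → (a :+ b) :* (x :* y) := (a :* x) :* y :+ x :* (b :* y)) refl _ _ _ _ ⟩
      (nat i * f i) * g (n ∸ i) + f i * (nat (n ∸ i) * g (n ∸ i)) ∎


  ∂-cong : ∀ {f g} → f ≋ g → ∂ f ≋ ∂ g
  ∂-cong f≋g n = *-congˡ (f≋g (suc n))

  ∂-⊕ : ∀ f g → ∂ (f ⊕ g) ≋ (∂ f ⊕ ∂ g)
  ∂-⊕ f g n = distribˡ _ _ _

  ∂-negS : ∀ f → ∂ (negS f) ≋ negS (∂ f)
  ∂-negS f n = solve 2 (λ m x → m :* (:- x) := :- (m :* x)) refl (nat (suc n)) (f (suc n))

  ∂-scale : ∀ a f → ∂ (scale a f) ≋ scale a (∂ f)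
  ∂-scale a f n = solve 3 (λ m a x → m :* (a :* x) := a :* (m :* x)) refl (nat (suc n)) a (f (suc n))

  ∂-constS : ∀ a → ∂ (constS a) ≋ zeroS
  ∂-constS a n = trans (*-congˡ (zeroʳ a)) (zeroʳ _)

  ∂-oneS : ∂ oneS ≋ zeroS
  ∂-oneS n = zeroʳ _

  ∂-X : ∂ X ≋ oneS
  ∂-X zero    = trans (*-identityʳ _) (+-identityʳ _)
  ∂-X (suc n) = zeroʳ _

  ∂-injective : ∀ {f g} → ∂ f ≋ ∂ g → f 0 ≈ g 0 → f ≋ g
  ∂-injective ∂f≋∂g f₀≈g₀ zero    = f₀≈g₀
  ∂-injective ∂f≋∂g f₀≈g₀ (suc n) = nat-*-cancelˡ n (∂f≋∂g n)

  θ-oneS : θ oneS ≋ zeroS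
  θ-oneS zero    = zeroˡ _
  θ-oneS (suc n) = zeroʳ _

  ⊛-cancelˡ-zero : ∀ a b f → a 0 * b ≈ 1# → (a ⊛ f) ≋ zeroS → f ≋ zeroS
  ⊛-cancelˡ-zero a b f a₀b≈1 af≋0 = <-rec _ step
    where
    open ≈-Reasoning
    step : ∀ k → (∀ {i} → i ℕ.< k → f i ≈ 0#) → f k ≈ 0#
    step k f<k≈0 = begin
      f k                 ≈⟨ trans (*-congˡ a₀b≈1) (*-identityʳ _) ⟨
      f k * (a 0 * b)     ≈⟨ *-assoc _ _ _ ⟨
      (f k * a 0) * b     ≈⟨ *-congʳ fₖa₀≈0 ⟩
      0# * b              ≈⟨ zeroˡ b ⟩
      0#                  ∎
      where
      fₖa₀≈0 : f k * a 0 ≈ 0#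
      fₖa₀≈0 = begin
        f k * a 0                                     ≈⟨ *-congˡ (reflexive (≡.cong a (ℕ.n∸n≡0 k))) ⟨
        f k * a (k ∸ k)                               ≈⟨ +-identityˡ _ ⟨
        0# + f k * a (k ∸ k)                          ≈⟨ +-congʳ (Σ<-zero k _ (λ i i<k → trans (*-congʳ (f<k≈0 i<k)) (zeroˡ _))) ⟨
        (f ⊛ a) k                                     ≈⟨ ⊛-comm f a k ⟩
        (a ⊛ f) k                                     ≈⟨ af≋0 k ⟩
        0#                                            ∎

  ⊛-cancelˡ : ∀ a b {f g} → a 0 * b ≈ 1# → (a ⊛ f) ≋ (a ⊛ g) → f ≋ g
  ⊛-cancelˡ a b {f} {g} a₀b≈1 af≋ag n = begin
    f n                  ≈⟨ solve 2 (λ x y → x := (x :- y) :+ y) refl (f n) (g n) ⟩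
    (f n - g n) + g n    ≈⟨ +-congʳ (f-g≋0 n) ⟩
    0# + g n             ≈⟨ +-identityˡ _ ⟩
    g n                  ∎
    where
    open ≈-Reasoning
    f-g≋0 : (f ⊕ negS g) ≋ zeroS
    f-g≋0 = ⊛-cancelˡ-zero a b (f ⊕ negS g) a₀b≈1 (≋-trans
      (SS.solve 3 (λ a f g → a SS.:* (f SS.:- g) SS.:= a SS.:* f SS.:- a SS.:* g) ≋-refl a f g)
      (≋-trans (⊕-cong af≋ag ≋-refl) (λ k → -‿inverseʳ _)))

  pow-vanishes-below : ∀ h → h 0 ≈ 0# → ∀ m n → n ℕ.< m → pow h m n ≈ 0#
  pow-vanishes-below h h₀≈0 (suc m) n n<1+m = begin
    (h ⊛ pow h m) n
      ≈⟨ Σ<-first n _ ⟩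
    h 0 * pow h m (n ∸ 0) + Σ< n (λ i → h (suc i) * pow h m (n ∸ suc i))
      ≈⟨ +-cong (trans (*-congʳ h₀≈0) (zeroˡ _)) (Σ<-zero n _ (λ i i<n →
           trans (*-congˡ (pow-vanishes-below h h₀≈0 m (n ∸ suc i) (n-1-i<m i i<n))) (zeroʳ _))) ⟩
    0# + 0#
      ≈⟨ +-identityʳ _ ⟩
    0# ∎
    where
    open ≈-Reasoning
    n-1-i<m : ∀ i → i ℕ.< n → n ∸ suc i ℕ.< m
    n-1-i<m i i<n = ℕ.<-≤-trans (ℕ.∸-monoʳ-< {n} {suc i} {0} (s≤s z≤n) i<n) (ℕ.≤-pred n<1+m)

  comp-as-Σ< : ∀ f h → h 0 ≈ 0# → ∀ n N → n ℕ.< N → comp f h n ≈ Σ< N (λ m → f m * pow h m n)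
  comp-as-Σ< f h h₀≈0 n (suc N) n<1+N with ℕ.m<1+n⇒m<n∨m≡n n<1+N
  ... | inj₂ ≡.refl = refl
  ... | inj₁ n<N    = trans (comp-as-Σ< f h h₀≈0 n N n<N) (sym (trans
    (+-congˡ (trans (*-congˡ (pow-vanishes-below h h₀≈0 N n n<N)) (zeroʳ _))) (+-identityʳ _)))

  comp-cong : ∀ {f f′} h → f ≋ f′ → comp f h ≋ comp f′ h
  comp-cong h f≋f′ n = Σ<-cong′ (suc n) (λ m → *-congʳ (f≋f′ m))

  comp-⊕ : ∀ f g h → comp (f ⊕ g) h ≋ (comp f h ⊕ comp g h)
  comp-⊕ f g h n = trans (Σ<-cong′ (suc n) (λ m → distribʳ _ _ _)) (Σ<-distrib-+ (suc n) _ _)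

  comp-at-0 : ∀ f h → comp f h 0 ≈ f 0
  comp-at-0 f h = trans (+-identityˡ _) (*-identityʳ _)

  comp-at-1 : ∀ f h → h 0 ≈ 0# → comp f h 1 ≈ f 1 * h 1
  comp-at-1 f h h₀≈0 = begin
    (0# + f 0 * 0#) + f 1 * (h ⊛ oneS) 1  ≈⟨ +-cong (trans (+-identityˡ _) (zeroʳ _)) (*-congˡ (⊛-oneS h 1)) ⟩
    0# + f 1 * h 1                        ≈⟨ +-identityˡ _ ⟩
    f 1 * h 1                             ∎
    where open ≈-Reasoning

  comp-oneS : ∀ h → comp oneS h ≋ oneS
  comp-oneS h n = begin
    comp oneS h n                                       ≈⟨ Σ<-first n _ ⟩
    1# * oneS n + Σ< n (λ m → 0# * pow h (suc m) n)     ≈⟨ +-cong (*-identityˡ _) (Σ<-zero n _ (λ _ _ → zeroˡ _)) ⟩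
    oneS n + 0#                                         ≈⟨ +-identityʳ _ ⟩
    oneS n                                              ∎
    where open ≈-Reasoning

  comp-X⊛ : ∀ f h → h 0 ≈ 0# → comp (X ⊛ f) h ≋ (h ⊛ comp f h)
  comp-X⊛ f h h₀≈0 n = begin
    comp (X ⊛ f) h n
      ≈⟨ comp-as-Σ< (X ⊛ f) h h₀≈0 n (suc (suc n)) (ℕ.m<n⇒m<1+n ℕ.≤-refl) ⟩
    Σ< (suc (suc n)) (λ m → (X ⊛ f) m * pow h m n)
      ≈⟨ Σ<-first (suc n) _ ⟩
    (X ⊛ f) 0 * pow h 0 n + Σ< (suc n) (λ m → (X ⊛ f) (suc m) * pow h (suc m) n)
      ≈⟨ +-cong (trans (*-congʳ (X⊛-zero f)) (zeroˡ _)) (Σ<-cong′ (suc n) (λ m → *-congʳ (X⊛-suc f m))) ⟩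
    0# + Σ< (suc n) (λ m → f m * Σ< (suc n) (λ i → h i * pow h m (n ∸ i)))
      ≈⟨ +-identityˡ _ ⟩
    Σ< (suc n) (λ m → f m * Σ< (suc n) (λ i → h i * pow h m (n ∸ i)))
      ≈⟨ Σ<-cong′ (suc n) (λ m → trans (sym (Σ<-*ˡ (suc n) (f m) _)) (Σ<-cong′ (suc n) (λ i →
           solve 3 (λ a b c → a :* (b :* c) := b :* (a :* c)) refl (f m) (h i) (pow h m (n ∸ i))))) ⟩
    Σ< (suc n) (λ m → Σ< (suc n) (λ i → h i * (f m * pow h m (n ∸ i))))
      ≈⟨ Σ<-swap (suc n) (suc n) _ ⟩
    Σ< (suc n) (λ i → Σ< (suc n) (λ m → h i * (f m * pow h m (n ∸ i))))
      ≈⟨ Σ<-cong′ (suc n) (λ i → trans (Σ<-*ˡ (suc n) (h i) _)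
           (*-congˡ (sym (comp-as-Σ< f h h₀≈0 (n ∸ i) (suc n) (s≤s (ℕ.m∸n≤m n i)))))) ⟩
    (h ⊛ comp f h) n ∎
    where open ≈-Reasoning

  θ-pow : ∀ h m → θ (pow h (suc m)) ≋ scale (nat (suc m)) (pow h m ⊛ θ h)
  θ-pow h zero = begin
    θ (h ⊛ oneS)                      ≈⟨ θ-⊛ h oneS ⟩
    (θ h ⊛ oneS) ⊕ (h ⊛ θ oneS)       ≈⟨ ⊕-cong ≋-refl (⊛-congˡ h θ-oneS) ⟩
    (θ h ⊛ oneS) ⊕ (h ⊛ zeroS)        ≈⟨ SS.solve 2 (λ a b → a SS.:* SS.# 1 SS.:+ b SS.:* SS.# 0 SS.:= SS.# 1 SS.:* a) ≋-refl (θ h) h ⟩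
    oneS ⊛ θ h                        ≈⟨ (λ k → trans (*-congʳ (+-identityʳ 1#)) (*-identityˡ _)) ⟨
    scale (nat 1) (oneS ⊛ θ h)        ∎
    where open ≋-Reasoning
  θ-pow h (suc m) = begin
    θ (h ⊛ P)
      ≈⟨ θ-⊛ h P ⟩
    (θ h ⊛ P) ⊕ (h ⊛ θ P)
      ≈⟨ ⊕-cong ≋-refl (⊛-congˡ h (≋-trans (θ-pow h m) (scale≋constS⊛ (nat (suc m)) _))) ⟩
    (θ h ⊛ P) ⊕ (h ⊛ (constS (nat (suc m)) ⊛ (pow h m ⊛ θ h)))
      ≈⟨ SS.solve 4 (λ θh h p c → θh SS.:* (h SS.:* p) SS.:+ h SS.:* (c SS.:* (p SS.:* θh))
                                  SS.:= (SS.# 1 SS.:+ c) SS.:* ((h SS.:* p) SS.:* θh)) ≋-refl (θ h) h (pow h m) (constS (nat (suc m))) ⟩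
    (oneS ⊕ constS (nat (suc m))) ⊛ (P ⊛ θ h)
      ≈⟨ ⊛-congʳ (P ⊛ θ h) (≋-sym (≋-trans (constS-+ 1# (nat (suc m))) (⊕-cong constS-1# ≋-refl))) ⟩
    constS (nat (suc (suc m))) ⊛ (P ⊛ θ h)
      ≈⟨ scale≋constS⊛ (nat (suc (suc m))) (P ⊛ θ h) ⟨
    scale (nat (suc (suc m))) (P ⊛ θ h) ∎
    where
    open ≋-Reasoning
    P : Series
    P = pow h (suc m)

  θ-comp : ∀ f h → h 0 ≈ 0# → θ (comp f h) ≋ (comp (∂ f) h ⊛ θ h)
  θ-comp f h h₀≈0 n = begin
    nat n * comp f h n
      ≈⟨ *-congˡ (comp-as-Σ< f h h₀≈0 n (suc (suc n)) (ℕ.m<n⇒m<1+n ℕ.≤-refl)) ⟩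
    nat n * Σ< (suc (suc n)) (λ m → f m * pow h m n)
      ≈⟨ trans (sym (Σ<-*ˡ (suc (suc n)) (nat n) _)) (Σ<-first (suc n) _) ⟩
    nat n * (f 0 * oneS n) + Σ< (suc n) (λ m → nat n * (f (suc m) * pow h (suc m) n))
      ≈⟨ +-cong (trans (x*[y*z]≈y*[x*z] _ _ _) (trans (*-congˡ (θ-oneS n)) (zeroʳ _)))
                (Σ<-cong′ (suc n) (λ m → trans (x*[y*z]≈y*[x*z] _ _ _) (*-congˡ (θ-pow h m n)))) ⟩
    0# + Σ< (suc n) (λ m → f (suc m) * (nat (suc m) * (pow h m ⊛ θ h) n))
      ≈⟨ trans (+-identityˡ _) (Σ<-cong′ (suc n) (λ m → sym (*-assoc _ _ _))) ⟩
    Σ< (suc n) (λ m → (f (suc m) * nat (suc m)) * (pow h m ⊛ θ h) n)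
      ≈⟨ Σ<-cong′ (suc n) (λ m → trans (*-congʳ (*-comm _ _)) (trans (sym (Σ<-*ˡ (suc n) (∂ f m) _))
           (Σ<-cong′ (suc n) (λ i → sym (*-assoc _ _ _))))) ⟩
    Σ< (suc n) (λ m → Σ< (suc n) (λ i → (∂ f m * pow h m i) * θ h (n ∸ i)))
      ≈⟨ Σ<-swap (suc n) (suc n) _ ⟩
    Σ< (suc n) (λ i → Σ< (suc n) (λ m → (∂ f m * pow h m i) * θ h (n ∸ i)))
      ≈⟨ Σ<-cong (suc n) (λ i i<1+n → trans (Σ<-*ʳ (suc n) (θ h (n ∸ i)) _)
           (*-congʳ (sym (comp-as-Σ< (∂ f) h h₀≈0 i (suc n) i<1+n)))) ⟩
    (comp (∂ f) h ⊛ θ h) n ∎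
    where
    open ≈-Reasoning
    x*[y*z]≈y*[x*z] : ∀ x y z → x * (y * z) ≈ y * (x * z)
    x*[y*z]≈y*[x*z] = solve 3 (λ x y z → x :* (y :* z) := y :* (x :* z)) refl

  ∂-comp : ∀ f h → h 0 ≈ 0# → ∂ (comp f h) ≋ (comp (∂ f) h ⊛ ∂ h)
  ∂-comp f h h₀≈0 = X⊛-cancelˡ (begin
    X ⊛ ∂ (comp f h)               ≈⟨ θ≋X⊛∂ (comp f h) ⟨
    θ (comp f h)                   ≈⟨ θ-comp f h h₀≈0 ⟩
    comp (∂ f) h ⊛ θ h             ≈⟨ ⊛-congˡ (comp (∂ f) h) (θ≋X⊛∂ h) ⟩
    comp (∂ f) h ⊛ (X ⊛ ∂ h)       ≈⟨ SS.solve 3 (λ a x b → a SS.:* (x SS.:* b) SS.:= x SS.:* (a SS.:* b)) ≋-refl (comp (∂ f) h) X (∂ h) ⟩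
    X ⊛ (comp (∂ f) h ⊛ ∂ h)       ∎)
    where open ≋-Reasoning

  ∂-⊛ : ∀ f g → ∂ (f ⊛ g) ≋ ((∂ f ⊛ g) ⊕ (f ⊛ ∂ g))
  ∂-⊛ f g = X⊛-cancelˡ (begin
    X ⊛ ∂ (f ⊛ g)                               ≈⟨ θ≋X⊛∂ (f ⊛ g) ⟨
    θ (f ⊛ g)                                   ≈⟨ θ-⊛ f g ⟩
    (θ f ⊛ g) ⊕ (f ⊛ θ g)                       ≈⟨ ⊕-cong (⊛-congʳ g (θ≋X⊛∂ f)) (⊛-congˡ f (θ≋X⊛∂ g)) ⟩
    ((X ⊛ ∂ f) ⊛ g) ⊕ (f ⊛ (X ⊛ ∂ g))           ≈⟨ SS.solve 5 (λ x df g f dg → (x SS.:* df) SS.:* g SS.:+ f SS.:* (x SS.:* dg)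
                                                                 SS.:= x SS.:* (df SS.:* g SS.:+ f SS.:* dg)) ≋-refl X (∂ f) g f (∂ g) ⟩
    X ⊛ ((∂ f ⊛ g) ⊕ (f ⊛ ∂ g))                 ∎)
    where open ≋-Reasoning

module HyperbolicODE {c ℓ : Level} (R : CommutativeRing c ℓ) (inv : ℕ → CommutativeRing.Carrier R)
                     (invSpec : PS.InvSpec R inv) where
  open CommutativeRing R
  open PS R inv
  open SeriesRing R inv
  open Calculus R inv invSpec
  open CommutativeRingSolver R using (solve; _:=_; _:+_; _:*_; _:-_; #)

  x²+4 : Series
  x²+4 = constS (nat 4) ⊕ (X ⊛ X)

  x²+4-at-0 : x²+4 0 ≈ nat 4
  x²+4-at-0 = trans (+-cong (*-identityʳ _) (X⊛-zero X)) (+-identityʳ _)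

  x²+4⊛ : ∀ g → (x²+4 ⊛ g) ≋ (scale (nat 4) g ⊕ (X ⊛ (X ⊛ g)))
  x²+4⊛ g = ≋-trans (⊛-distribʳ g (constS (nat 4)) (X ⊛ X))
                   (⊕-cong (≋-sym (scale≋constS⊛ (nat 4) g)) (⊛-assoc X X g))

  ∂-x²+4 : ∂ x²+4 ≋ (X ⊕ X)
  ∂-x²+4 = begin
    ∂ (constS (nat 4) ⊕ (X ⊛ X))           ≈⟨ ≋-trans (∂-⊕ (constS (nat 4)) (X ⊛ X)) (⊕-cong (∂-constS (nat 4)) (∂-⊛ X X)) ⟩
    zeroS ⊕ ((∂ X ⊛ X) ⊕ (X ⊛ ∂ X))        ≈⟨ ⊕-cong ≋-refl (⊕-cong (⊛-congʳ X ∂-X) (⊛-congˡ X ∂-X)) ⟩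
    zeroS ⊕ ((oneS ⊛ X) ⊕ (X ⊛ oneS))      ≈⟨ SS.solve 1 (λ x → SS.# 0 SS.:+ (SS.# 1 SS.:* x SS.:+ x SS.:* SS.# 1) SS.:= x SS.:+ x) ≋-refl X ⟩
    X ⊕ X                                  ∎
    where open ≋-Reasoning

  X⊛X⊛∂-suc : ∀ f m → (X ⊛ (X ⊛ ∂ f)) (suc m) ≈ nat m * f m
  X⊛X⊛∂-suc f m = trans (X⊛-suc (X ⊛ ∂ f) m) (sym (θ≋X⊛∂ f m))

  θ∘θ : ∀ F → θ (θ F) ≋ ((X ⊛ (X ⊛ ∂ (∂ F))) ⊕ (X ⊛ ∂ F))
  θ∘θ F = begin
    θ (θ F)                                  ≈⟨ θ-cong (θ≋X⊛∂ F) ⟩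
    θ (X ⊛ ∂ F)                              ≈⟨ θ-⊛ X (∂ F) ⟩
    (θ X ⊛ ∂ F) ⊕ (X ⊛ θ (∂ F))              ≈⟨ ⊕-cong (⊛-congʳ (∂ F) θ-X) (⊛-congˡ X (θ≋X⊛∂ (∂ F))) ⟩
    (X ⊛ ∂ F) ⊕ (X ⊛ (X ⊛ ∂ (∂ F)))          ≈⟨ ⊕-comm (X ⊛ ∂ F) _ ⟩
    (X ⊛ (X ⊛ ∂ (∂ F))) ⊕ (X ⊛ ∂ F)          ∎
    where
    open ≋-Reasoning
    θ-cong : ∀ {f g} → f ≋ g → θ f ≋ θ g
    θ-cong f≋g n = *-congˡ (f≋g n)
    θ-X : θ X ≋ X
    θ-X zero          = zeroˡ _
    θ-X (suc zero)    = trans (*-identityʳ _) (+-identityʳ 1#)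
    θ-X (suc (suc n)) = zeroʳ _

  SolvesODE : Carrier → Series → Set ℓ
  SolvesODE a F = ((x²+4 ⊛ ∂ (∂ F)) ⊕ (X ⊛ ∂ F)) ≋ scale a F

  InverseSqrtDerivative : Series → Set ℓ
  InverseSqrtDerivative G = (x²+4 ⊛ (∂ G ⊛ ∂ G)) ≋ oneS

  -- Differentiating (x²+4) G′² = 1 gives 2 G′ ((x²+4) G″ + x G′) = 0, and G′ is a unit since 4 G′(0)² = 1.
  inverseSqrtDerivative-ode : ∀ G → InverseSqrtDerivative G → ((x²+4 ⊛ ∂ (∂ G)) ⊕ (X ⊛ ∂ G)) ≋ zeroS
  inverseSqrtDerivative-ode G Q∂G²≋1 = ⊛-cancelˡ-zero (∂ G ⊕ ∂ G) (∂ G 0 + ∂ G 0) _ unit (begin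
    (∂ G ⊕ ∂ G) ⊛ ((x²+4 ⊛ ∂ (∂ G)) ⊕ (X ⊛ ∂ G))
      ≈⟨ SS.solve 4 (λ g dg q x → (g SS.:+ g) SS.:* (q SS.:* dg SS.:+ x SS.:* g) SS.:=
                                  (x SS.:+ x) SS.:* (g SS.:* g) SS.:+ q SS.:* (dg SS.:* g SS.:+ g SS.:* dg)) ≋-refl (∂ G) (∂ (∂ G)) x²+4 X ⟩
    ((X ⊕ X) ⊛ (∂ G ⊛ ∂ G)) ⊕ (x²+4 ⊛ ((∂ (∂ G) ⊛ ∂ G) ⊕ (∂ G ⊛ ∂ (∂ G))))
      ≈⟨ ⊕-cong (⊛-congʳ (∂ G ⊛ ∂ G) (≋-sym ∂-x²+4)) (⊛-congˡ x²+4 (≋-sym (∂-⊛ (∂ G) (∂ G)))) ⟩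
    (∂ x²+4 ⊛ (∂ G ⊛ ∂ G)) ⊕ (x²+4 ⊛ ∂ (∂ G ⊛ ∂ G))
      ≈⟨ ∂-⊛ x²+4 (∂ G ⊛ ∂ G) ⟨
    ∂ (x²+4 ⊛ (∂ G ⊛ ∂ G))
      ≈⟨ ≋-trans (∂-cong Q∂G²≋1) ∂-oneS ⟩
    zeroS ∎)
    where
    open ≋-Reasoning
    unit : (∂ G ⊕ ∂ G) 0 * (∂ G 0 + ∂ G 0) ≈ 1#
    unit = trans (solve 1 (λ g → (g :+ g) :* (g :+ g) := # 4 :* (g :* g)) refl (∂ G 0))
      (trans (*-cong (sym x²+4-at-0) (sym (⊛-zero (∂ G) (∂ G))))
        (trans (sym (⊛-zero x²+4 (∂ G ⊛ ∂ G))) (Q∂G²≋1 0)))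

  -- For F = Φ (t G): F′ = t Φ′(tG) G′ and F″ = t² Φ(tG) G′² + t Φ′(tG) G″.
  ode-comp : ∀ Φ G t → ∂ (∂ Φ) ≋ Φ → G 0 ≈ 0# → InverseSqrtDerivative G → SolvesODE (t * t) (comp Φ (scale t G))
  ode-comp Φ G t ∂²Φ≋Φ G₀≈0 Q∂G²≋1 = begin
    (x²+4 ⊛ ∂ (∂ F)) ⊕ (X ⊛ ∂ F)
      ≈⟨ ⊕-cong (⊛-congˡ x²+4 ∂²F) (⊛-congˡ X ∂F) ⟩
    (x²+4 ⊛ (((F ⊛ (T ⊛ ∂ G)) ⊛ (T ⊛ ∂ G)) ⊕ (Φ′ ⊛ (T ⊛ ∂ (∂ G))))) ⊕ (X ⊛ (Φ′ ⊛ (T ⊛ ∂ G)))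
      ≈⟨ SS.solve 7 (λ q f t g dg c x → q SS.:* ((f SS.:* (t SS.:* g)) SS.:* (t SS.:* g) SS.:+ c SS.:* (t SS.:* dg)) SS.:+ x SS.:* (c SS.:* (t SS.:* g))
                    SS.:= ((t SS.:* t) SS.:* f) SS.:* (q SS.:* (g SS.:* g)) SS.:+ (c SS.:* t) SS.:* (q SS.:* dg SS.:+ x SS.:* g))
                    ≋-refl x²+4 F T (∂ G) (∂ (∂ G)) Φ′ X ⟩
    (((T ⊛ T) ⊛ F) ⊛ (x²+4 ⊛ (∂ G ⊛ ∂ G))) ⊕ ((Φ′ ⊛ T) ⊛ ((x²+4 ⊛ ∂ (∂ G)) ⊕ (X ⊛ ∂ G)))
      ≈⟨ ⊕-cong (⊛-congˡ ((T ⊛ T) ⊛ F) Q∂G²≋1) (⊛-congˡ (Φ′ ⊛ T) (inverseSqrtDerivative-ode G Q∂G²≋1)) ⟩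
    (((T ⊛ T) ⊛ F) ⊛ oneS) ⊕ ((Φ′ ⊛ T) ⊛ zeroS)
      ≈⟨ SS.solve 2 (λ a b → a SS.:* SS.# 1 SS.:+ b SS.:* SS.# 0 SS.:= a) ≋-refl ((T ⊛ T) ⊛ F) (Φ′ ⊛ T) ⟩
    (T ⊛ T) ⊛ F
      ≈⟨ ≋-trans (⊛-congʳ F (≋-sym (constS-* t t))) (≋-sym (scale≋constS⊛ (t * t) F)) ⟩
    scale (t * t) F ∎
    where
    open ≋-Reasoning
    h : Series
    h = scale t G
    F : Series
    F = comp Φ h
    T : Series
    T = constS t
    Φ′ : Series
    Φ′ = comp (∂ Φ) h
    h₀≈0 : h 0 ≈ 0#
    h₀≈0 = trans (*-congˡ G₀≈0) (zeroʳ t)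
    ∂h : ∂ h ≋ (T ⊛ ∂ G)
    ∂h = ≋-trans (∂-scale t G) (scale≋constS⊛ t (∂ G))
    ∂F : ∂ F ≋ (Φ′ ⊛ (T ⊛ ∂ G))
    ∂F = ≋-trans (∂-comp Φ h h₀≈0) (⊛-congˡ Φ′ ∂h)
    ∂²F : ∂ (∂ F) ≋ (((F ⊛ (T ⊛ ∂ G)) ⊛ (T ⊛ ∂ G)) ⊕ (Φ′ ⊛ (T ⊛ ∂ (∂ G))))
    ∂²F = begin
      ∂ (∂ F)                                              ≈⟨ ∂-cong (∂-comp Φ h h₀≈0) ⟩
      ∂ (Φ′ ⊛ ∂ h)                                         ≈⟨ ∂-⊛ Φ′ (∂ h) ⟩
      (∂ Φ′ ⊛ ∂ h) ⊕ (Φ′ ⊛ ∂ (∂ h))                        ≈⟨ ⊕-cong (⊛-congʳ (∂ h) (∂-comp (∂ Φ) h h₀≈0)) ≋-refl ⟩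
      ((comp (∂ (∂ Φ)) h ⊛ ∂ h) ⊛ ∂ h) ⊕ (Φ′ ⊛ ∂ (∂ h))    ≈⟨ ⊕-cong (⊛-cong (⊛-cong (comp-cong h ∂²Φ≋Φ) ∂h) ∂h) (⊛-congˡ Φ′ ∂²h) ⟩
      ((F ⊛ (T ⊛ ∂ G)) ⊛ (T ⊛ ∂ G)) ⊕ (Φ′ ⊛ (T ⊛ ∂ (∂ G))) ∎
      where
      ∂²h : ∂ (∂ h) ≋ (T ⊛ ∂ (∂ G))
      ∂²h = ≋-trans (∂-cong (∂-scale t G)) (≋-trans (∂-scale t (∂ G)) (scale≋constS⊛ t (∂ (∂ G))))

  Recurrence : Carrier → Series → Set ℓ
  Recurrence a F = ∀ n → nat 4 * ∂ (∂ F) n ≈ (a - nat n * nat n) * F n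

  ode⇒recurrence : ∀ a F → SolvesODE a F → Recurrence a F
  ode⇒recurrence a F ode n = begin
    nat 4 * ∂ (∂ F) n                                   ≈⟨ solve 3 (λ y n f → y := (y :+ n :* (n :* f)) :- n :* (n :* f)) refl _ (nat n) (F n) ⟩
    (nat 4 * ∂ (∂ F) n + θ (θ F) n) - nat n * θ F n     ≈⟨ +-congʳ coefficient ⟩
    a * F n - nat n * (nat n * F n)                     ≈⟨ solve 3 (λ a n f → a :* f :- n :* (n :* f) := (a :- n :* n) :* f) refl a (nat n) (F n) ⟩
    (a - nat n * nat n) * F n                           ∎
    where
    open ≈-Reasoning
    coefficient : nat 4 * ∂ (∂ F) n + θ (θ F) n ≈ a * F n
    coefficient = begin
      nat 4 * ∂ (∂ F) n + θ (θ F) n                                        ≈⟨ +-congˡ (θ∘θ F n) ⟩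
      nat 4 * ∂ (∂ F) n + ((X ⊛ (X ⊛ ∂ (∂ F))) n + (X ⊛ ∂ F) n)            ≈⟨ +-assoc _ _ _ ⟨
      (nat 4 * ∂ (∂ F) n + (X ⊛ (X ⊛ ∂ (∂ F))) n) + (X ⊛ ∂ F) n            ≈⟨ +-congʳ (x²+4⊛ (∂ (∂ F)) n) ⟨
      (x²+4 ⊛ ∂ (∂ F)) n + (X ⊛ ∂ F) n                                     ≈⟨ ode n ⟩
      a * F n                                                              ∎

  recurrence-unique : ∀ {a F G} → Recurrence a F → Recurrence a G → F 0 ≈ G 0 → F 1 ≈ G 1 → F ≋ G
  recurrence-unique {a} {F} {G} recF recG F₀≈G₀ F₁≈G₁ n = proj₁ (agree n)
    where
    open ≈-Reasoning
    agree : ∀ n → (F n ≈ G n) × (F (suc n) ≈ G (suc n))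
    agree zero    = F₀≈G₀ , F₁≈G₁
    agree (suc n) = proj₂ (agree n) , nat-*-cancelˡ (suc n) (nat-*-cancelˡ n (nat-*-cancelˡ 3 (begin
      nat 4 * ∂ (∂ F) n           ≈⟨ recF n ⟩
      (a - nat n * nat n) * F n   ≈⟨ *-congˡ (proj₁ (agree n)) ⟩
      (a - nat n * nat n) * G n   ≈⟨ recG n ⟨
      nat 4 * ∂ (∂ G) n           ∎)))

  recurrence-⊖ : ∀ {a F G} → Recurrence a F → Recurrence a G → Recurrence a (F ⊖ G)
  recurrence-⊖ {a} {F} {G} recF recG n = begin
    nat 4 * (p * (q * (F (suc (suc n)) - G (suc (suc n)))))
      ≈⟨ solve 5 (λ r p q f g → r :* (p :* (q :* (f :- g))) := r :* (p :* (q :* f)) :- r :* (p :* (q :* g))) refl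
           (nat 4) p q (F (suc (suc n))) (G (suc (suc n))) ⟩
    nat 4 * ∂ (∂ F) n - nat 4 * ∂ (∂ G) n
      ≈⟨ +-cong (recF n) (-‿cong (recG n)) ⟩
    (a - nat n * nat n) * F n - (a - nat n * nat n) * G n
      ≈⟨ solve 3 (λ k f g → k :* f :- k :* g := k :* (f :- g)) refl (a - nat n * nat n) (F n) (G n) ⟩
    (a - nat n * nat n) * (F n - G n) ∎
    where
    open ≈-Reasoning
    p q : Carrier
    p = nat (suc n)
    q = nat (suc (suc n))

  recurrence-scale : ∀ {a} b {F} → Recurrence a F → Recurrence a (scale b F)
  recurrence-scale {a} b {F} recF n = begin
    nat 4 * (p * (q * (b * F (suc (suc n)))))
      ≈⟨ solve 5 (λ r p q b f → r :* (p :* (q :* (b :* f))) := b :* (r :* (p :* (q :* f)))) refl (nat 4) p q b (F (suc (suc n))) ⟩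
    b * (nat 4 * ∂ (∂ F) n)            ≈⟨ *-congˡ (recF n) ⟩
    b * ((a - nat n * nat n) * F n)    ≈⟨ solve 3 (λ b k f → b :* (k :* f) := k :* (b :* f)) refl b (a - nat n * nat n) (F n) ⟩
    (a - nat n * nat n) * (b * F n)    ∎
    where
    open ≈-Reasoning
    p q : Carrier
    p = nat (suc n)
    q = nat (suc (suc n))

  recurrence-cong : ∀ {a b F} → a ≈ b → Recurrence a F → Recurrence b F
  recurrence-cong a≈b recF n = trans (recF n) (*-congʳ (+-congʳ a≈b))

data Parity : ℕ → Set where
  even : ∀ k → Parity (k ℕ.+ k)
  odd  : ∀ k → Parity (suc (k ℕ.+ k))

parity : ∀ n → Parity n
parity zero = even 0
parity (suc n) with parity n
... | even k = odd k
... | odd k  = ≡.subst Parity (≡.cong suc (ℕ.+-suc k k)) (even (suc k))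

module Coefficients {c ℓ : Level} (R : CommutativeRing c ℓ) (inv : ℕ → CommutativeRing.Carrier R)
                    (invSpec : PS.InvSpec R inv) where
  open CommutativeRing R
  open PS R inv
  open Sums R inv
  open SeriesRing R inv
  open Calculus R inv invSpec
  open CommutativeRingSolver R using (solve; _:=_; _:+_; _:*_; _:-_; #)

  inv-1 : inv 1 ≈ 1#
  inv-1 = trans (solve 1 (λ i → i := (# 1 :+ # 0) :* i) refl (inv 1)) (invSpec 0)

  nat-*-invFact-suc : ∀ m → nat (suc m) * invFact (suc m) ≈ invFact m
  nat-*-invFact-suc m = begin
    nat (suc m) * (invFact m * inv (suc m))   ≈⟨ solve 3 (λ n f i → n :* (f :* i) := f :* (n :* i)) refl (nat (suc m)) (invFact m) (inv (suc m)) ⟩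
    invFact m * (nat (suc m) * inv (suc m))   ≈⟨ *-congˡ (invSpec m) ⟩
    invFact m * 1#                            ≈⟨ *-identityʳ _ ⟩
    invFact m                                 ∎
    where open ≈-Reasoning

  binom-cong : ∀ {s s′} m → s ≈ s′ → binom s m ≈ binom s′ m
  binom-cong m s≈s′ = *-congʳ (Π<-cong m (λ j → +-congʳ s≈s′))

  binom-suc : ∀ s m → binom s (suc m) ≈ binom s m * ((s - nat m) * inv (suc m))
  binom-suc s m = solve 4 (λ p x f i → (p :* x) :* (f :* i) := (p :* f) :* (x :* i)) refl
                    (Π< m (λ j → s - nat j)) (s - nat m) (invFact m) (inv (suc m))

  binom-+1 : ∀ s m → binom (s + 1#) (suc m) ≈ (s + 1#) * (binom s m * inv (suc m))
  binom-+1 s m = begin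
    Π< (suc m) (λ j → s + 1# - nat j) * (invFact m * inv (suc m))
      ≈⟨ *-congʳ (trans (Π<-first m _) (*-congˡ (Π<-cong m (λ j →
           solve 2 (λ s n → s :+ # 1 :- (# 1 :+ n) := s :- n) refl s (nat j))))) ⟩
    ((s + 1#) - 0#) * Π< m (λ j → s - nat j) * (invFact m * inv (suc m))
      ≈⟨ solve 5 (λ s p f i z → ((s :+ # 1) :- # 0) :* p :* (f :* i) := (s :+ # 1) :* ((p :* f) :* i)) refl
           s (Π< m (λ j → s - nat j)) (invFact m) (inv (suc m)) 0# ⟩
    (s + 1#) * (binom s m * inv (suc m)) ∎
    where open ≈-Reasoning

  oddPart-odd : ∀ g k → oddPart g (suc (k ℕ.+ k)) ≡ g k
  oddPart-odd g zero    = ≡.refl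
  oddPart-odd g (suc k) rewrite ℕ.+-suc k k = oddPart-odd (λ j → g (suc j)) k

  oddPart-even : ∀ g k → oddPart g (k ℕ.+ k) ≡ 0#
  oddPart-even g zero    = ≡.refl
  oddPart-even g (suc k) rewrite ℕ.+-suc k k = oddPart-even (λ j → g (suc j)) k

  evenPart-even : ∀ g k → evenPart g (k ℕ.+ k) ≡ g k
  evenPart-even g zero    = ≡.refl
  evenPart-even g (suc k) rewrite ℕ.+-suc k k = evenPart-even (λ j → g (suc j)) k

  evenPart-odd : ∀ g k → evenPart g (suc (k ℕ.+ k)) ≡ 0#
  evenPart-odd g zero    = ≡.refl
  evenPart-odd g (suc k) rewrite ℕ.+-suc k k = evenPart-odd (λ j → g (suc j)) k

  oddPart-cong : ∀ {g h} → (∀ k → g k ≈ h k) → oddPart g ≋ oddPart h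
  oddPart-cong g≈h zero          = refl
  oddPart-cong g≈h (suc zero)    = g≈h 0
  oddPart-cong g≈h (suc (suc n)) = oddPart-cong (λ k → g≈h (suc k)) n

  evenPart-cong : ∀ {g h} → (∀ k → g k ≈ h k) → evenPart g ≋ evenPart h
  evenPart-cong g≈h zero          = g≈h 0
  evenPart-cong g≈h (suc zero)    = refl
  evenPart-cong g≈h (suc (suc n)) = evenPart-cong (λ k → g≈h (suc k)) n

  ∂-oddPart : ∀ g → ∂ (oddPart g) ≋ evenPart (λ k → nat (suc (k ℕ.+ k)) * g k)
  ∂-oddPart g n with parity n
  ... | even k = reflexive (≡.trans (≡.cong (nat (suc (k ℕ.+ k)) *_) (oddPart-odd g k)) (≡.sym (evenPart-even _ k)))
  ... | odd k  = trans (*-congˡ (reflexive (oddPart-even (λ j → g (suc j)) k)))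
                       (trans (zeroʳ _) (reflexive (≡.sym (evenPart-odd _ k))))

  ∂-evenPart : ∀ g → ∂ (evenPart g) ≋ oddPart (λ k → nat (suc (suc (k ℕ.+ k))) * g (suc k))
  ∂-evenPart g n with parity n
  ... | even k = trans (*-congˡ (reflexive (evenPart-odd g k)))
                       (trans (zeroʳ _) (reflexive (≡.sym (oddPart-even _ k))))
  ... | odd k  = reflexive (≡.trans (≡.cong (nat (suc (suc (k ℕ.+ k))) *_) (evenPart-even (λ j → g (suc j)) k))
                                    (≡.sym (oddPart-odd _ k)))

  ∂-expS : ∂ expS ≋ expS
  ∂-expS = nat-*-invFact-suc

  coshS : Series
  coshS = evenPart (λ k → invFact (k ℕ.+ k))

  ∂-sinhS : ∂ sinhS ≋ coshS
  ∂-sinhS = ≋-trans (∂-oddPart _) (evenPart-cong (λ k → nat-*-invFact-suc (k ℕ.+ k)))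

  ∂-coshS : ∂ coshS ≋ sinhS
  ∂-coshS = ≋-trans (∂-evenPart _) (oddPart-cong (λ k →
    trans (*-congˡ (reflexive (≡.cong (λ m → invFact (suc m)) (ℕ.+-suc k k))))
          (nat-*-invFact-suc (suc (k ℕ.+ k)))))

module LambdaSeries {c ℓ : Level} (R : CommutativeRing c ℓ) (inv : ℕ → CommutativeRing.Carrier R)
                    (invSpec : PS.InvSpec R inv) where
  open CommutativeRing R
  open PS R inv
  open SeriesRing R inv
  open Calculus R inv invSpec
  open HyperbolicODE R inv invSpec
  open Coefficients R inv invSpec
  open CommutativeRingSolver R using (solve; _:=_; _:+_; _:*_; _:-_; #)

  oddPart-recurrence : ∀ a g →
    (∀ k → nat 4 * (nat (suc (suc (k ℕ.+ k))) * (nat (suc (suc (suc (k ℕ.+ k)))) * g (suc k)))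
             ≈ (a - nat (suc (k ℕ.+ k)) * nat (suc (k ℕ.+ k))) * g k) →
    Recurrence a (oddPart g)
  oddPart-recurrence a g step n with parity n
  ... | even k = begin
    nat 4 * (nat (suc (k ℕ.+ k)) * (nat (suc (suc (k ℕ.+ k))) * oddPart (λ j → g (suc j)) (k ℕ.+ k)))
      ≈⟨ *-congˡ (*-congˡ (*-congˡ (reflexive (oddPart-even _ k)))) ⟩
    nat 4 * (nat (suc (k ℕ.+ k)) * (nat (suc (suc (k ℕ.+ k))) * 0#))
      ≈⟨ solve 4 (λ a b c d → a :* (b :* (c :* # 0)) := d :* # 0) refl _ _ _ _ ⟩
    (a - nat (k ℕ.+ k) * nat (k ℕ.+ k)) * 0#
      ≈⟨ *-congˡ (reflexive (oddPart-even g k)) ⟨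
    (a - nat (k ℕ.+ k) * nat (k ℕ.+ k)) * oddPart g (k ℕ.+ k) ∎
    where open ≈-Reasoning
  ... | odd k = begin
    nat 4 * (nat (suc (suc (k ℕ.+ k))) * (nat (suc (suc (suc (k ℕ.+ k)))) * oddPart (λ j → g (suc j)) (suc (k ℕ.+ k))))
      ≈⟨ *-congˡ (*-congˡ (*-congˡ (reflexive (oddPart-odd _ k)))) ⟩
    nat 4 * (nat (suc (suc (k ℕ.+ k))) * (nat (suc (suc (suc (k ℕ.+ k)))) * g (suc k)))
      ≈⟨ step k ⟩
    (a - nat (suc (k ℕ.+ k)) * nat (suc (k ℕ.+ k))) * g k
      ≈⟨ *-congˡ (reflexive (oddPart-odd g k)) ⟨
    (a - nat (suc (k ℕ.+ k)) * nat (suc (k ℕ.+ k))) * oddPart g (suc (k ℕ.+ k)) ∎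
    where open ≈-Reasoning

  module _ (t : Carrier) where
    w : Carrier
    w = (t - 1#) * half

    λ₁ : ℕ → Carrier
    λ₁ k = t * inv (suc (k ℕ.+ k)) * binom (w + nat k) (k ℕ.+ k)

    -- Since 2 w = t - 1, the two factors doubled are t + (1 + 2K) and t - (1 + 2K).
    difference-of-squares : ∀ K → nat 4 * ((w + K + 1#) * (w + K + 1# - (1# + (K + K))))
                                  ≈ t * t - (1# + (K + K)) * (1# + (K + K))
    difference-of-squares K = begin
      nat 4 * ((w + K + 1#) * (w + K + 1# - (1# + (K + K))))
        ≈⟨ solve 3 (λ t h K → # 4 :* ((((t :- # 1) :* h) :+ K :+ # 1) :* (((t :- # 1) :* h) :+ K :+ # 1 :- (# 1 :+ (K :+ K))))
                   := ((t :- # 1) :* (# 2 :* h) :+ # 1 :+ (# 1 :+ (K :+ K))) :* ((t :- # 1) :* (# 2 :* h) :+ # 1 :- (# 1 :+ (K :+ K))))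
                   refl t half K ⟩
      ((t - 1#) * (nat 2 * half) + 1# + u) * ((t - 1#) * (nat 2 * half) + 1# - u)
        ≈⟨ *-cong (+-congʳ (+-congʳ (*-congˡ (invSpec 1)))) (+-congʳ (+-congʳ (*-congˡ (invSpec 1)))) ⟩
      ((t - 1#) * 1# + 1# + u) * ((t - 1#) * 1# + 1# - u)
        ≈⟨ solve 2 (λ t c → ((t :- # 1) :* # 1 :+ # 1 :+ c) :* ((t :- # 1) :* # 1 :+ # 1 :- c) := t :* t :- c :* c) refl t u ⟩
      t * t - u * u ∎
      where
      open ≈-Reasoning
      u : Carrier
      u = 1# + (K + K)

    λ₁-step : ∀ k → nat 4 * (nat (suc (suc (k ℕ.+ k))) * (nat (suc (suc (suc (k ℕ.+ k)))) * λ₁ (suc k)))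
                    ≈ (t * t - nat (suc (k ℕ.+ k)) * nat (suc (k ℕ.+ k))) * λ₁ k
    λ₁-step k = begin
      nat 4 * (N₂ * (N₃ * λ₁ (suc k)))
        ≈⟨ *-congˡ (*-congˡ (*-congˡ λ₁-suc)) ⟩
      nat 4 * (N₂ * (N₃ * (t * i₃ * ((a + 1#) * (B * i₁) * ((a + 1# - N₁) * i₂)))))
        ≈⟨ solve 10 (λ n₂ n₃ t i₃ a₁ b i₁ d i₂ n₄ → n₄ :* (n₂ :* (n₃ :* (t :* i₃ :* (a₁ :* (b :* i₁) :* (d :* i₂)))))
                     := ((n₃ :* i₃) :* (n₂ :* i₂)) :* (n₄ :* (a₁ :* d)) :* (t :* i₁ :* b))
                     refl N₂ N₃ t i₃ (a + 1#) B i₁ (a + 1# - N₁) i₂ (nat 4) ⟩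
      ((N₃ * i₃) * (N₂ * i₂)) * (nat 4 * ((a + 1#) * (a + 1# - N₁))) * λ₁ k
        ≈⟨ *-congʳ (*-cong (*-cong (invSpec (suc (suc m))) (invSpec (suc m))) four-products) ⟩
      (1# * 1#) * (t * t - N₁ * N₁) * λ₁ k
        ≈⟨ *-congʳ (trans (*-congʳ (*-identityʳ 1#)) (*-identityˡ _)) ⟩
      (t * t - N₁ * N₁) * λ₁ k ∎
      where
      open ≈-Reasoning
      m : ℕ
      m = k ℕ.+ k
      N₁ N₂ N₃ i₁ i₂ i₃ a B : Carrier
      N₁ = nat (suc m)
      N₂ = nat (suc (suc m))
      N₃ = nat (suc (suc (suc m)))
      i₁ = inv (suc m)
      i₂ = inv (suc (suc m))
      i₃ = inv (suc (suc (suc m)))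
      a = w + nat k
      B = binom a m
      λ₁-suc : λ₁ (suc k) ≈ t * i₃ * ((a + 1#) * (B * i₁) * ((a + 1# - N₁) * i₂))
      λ₁-suc = begin
        λ₁ (suc k)
          ≡⟨ ≡.cong (λ n → t * inv (suc n) * binom (w + nat (suc k)) n) (≡.cong suc (ℕ.+-suc k k)) ⟩
        t * i₃ * binom (w + (1# + nat k)) (suc (suc m))
          ≈⟨ *-congˡ (binom-cong (suc (suc m)) (solve 2 (λ w K → w :+ (# 1 :+ K) := w :+ K :+ # 1) refl w (nat k))) ⟩
        t * i₃ * binom (a + 1#) (suc (suc m))
          ≈⟨ *-congˡ (trans (binom-suc (a + 1#) (suc m)) (*-congʳ (binom-+1 a m))) ⟩
        t * i₃ * ((a + 1#) * (B * i₁) * ((a + 1# - N₁) * i₂)) ∎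
      four-products : nat 4 * ((a + 1#) * (a + 1# - N₁)) ≈ t * t - N₁ * N₁
      four-products = begin
        nat 4 * ((a + 1#) * (a + 1# - N₁))
          ≈⟨ *-congˡ (*-congˡ (+-congˡ (-‿cong N₁≈))) ⟩
        nat 4 * ((a + 1#) * (a + 1# - (1# + (nat k + nat k))))
          ≈⟨ difference-of-squares (nat k) ⟩
        t * t - (1# + (nat k + nat k)) * (1# + (nat k + nat k))
          ≈⟨ +-congˡ (-‿cong (*-cong N₁≈ N₁≈)) ⟨
        t * t - N₁ * N₁ ∎
        where
        N₁≈ : N₁ ≈ 1# + (nat k + nat k)
        N₁≈ = +-congˡ (nat-+ k k)

    Λ₁-recurrence : Recurrence (t * t) (Λ₁ t)
    Λ₁-recurrence = oddPart-recurrence (t * t) λ₁ λ₁-step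

    Λ₁-at-1 : Λ₁ t 1 ≈ t
    Λ₁-at-1 = begin
      t * inv 1 * (1# * 1#)   ≈⟨ *-cong (*-congˡ inv-1) (*-identityˡ 1#) ⟩
      t * 1# * 1#             ≈⟨ trans (*-identityʳ _) (*-identityʳ t) ⟩
      t                       ∎
      where open ≈-Reasoning

module SquareRoot {c ℓ : Level} (R : CommutativeRing c ℓ) (inv : ℕ → CommutativeRing.Carrier R)
                  (invSpec : PS.InvSpec R inv) where
  open CommutativeRing R
  open PS R inv
  open SeriesRing R inv
  open Calculus R inv invSpec
  open HyperbolicODE R inv invSpec
  open Coefficients R inv invSpec
  open CommutativeRingSolver R using (solve; _:=_; _:+_; _:*_; _:-_; #)

  sqrtCoefficient : ℕ → Carrier
  sqrtCoefficient j = nat 2 * (binom half j * (inv 4 ^ j))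

  sqrtCoefficient-step : ∀ j → nat 4 * (nat (suc (suc (j ℕ.+ j))) * sqrtCoefficient (suc j)) + nat (j ℕ.+ j) * sqrtCoefficient j
                               ≈ sqrtCoefficient j
  sqrtCoefficient-step j = begin
    nat 4 * (nat (suc (suc (j ℕ.+ j))) * (nat 2 * (binom half (suc j) * (W * q)))) + nat (j ℕ.+ j) * S
      ≈⟨ +-cong (*-congˡ (*-cong (+-congˡ (+-congˡ (nat-+ j j))) (*-congˡ (*-congʳ (binom-suc half j))))) (*-congʳ (nat-+ j j)) ⟩
    nat 4 * ((1# + (1# + (J + J))) * (nat 2 * ((B * ((half - J) * i)) * (W * q)))) + (J + J) * S
      ≈⟨ solve 6 (λ J h B i W q → # 4 :* ((# 1 :+ (# 1 :+ (J :+ J))) :* (# 2 :* ((B :* ((h :- J) :* i)) :* (W :* q))))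
                                   :+ (J :+ J) :* (# 2 :* (B :* W))
                                := (# 4 :* q) :* ((# 1 :+ J) :* i) :* (# 2 :* (B :* W) :* (# 2 :* (h :- J))) :+ (J :+ J) :* (# 2 :* (B :* W)))
           refl J half B i W q ⟩
    (nat 4 * q) * ((1# + J) * i) * (S * (nat 2 * (half - J))) + (J + J) * S
      ≈⟨ +-congʳ (*-congʳ (trans (*-cong (invSpec 3) (invSpec j)) (*-identityˡ 1#))) ⟩
    1# * (S * (nat 2 * (half - J))) + (J + J) * S
      ≈⟨ solve 3 (λ S h J → # 1 :* (S :* (# 2 :* (h :- J))) :+ (J :+ J) :* S := S :* (# 2 :* h)) refl S half J ⟩
    S * (nat 2 * half)
      ≈⟨ trans (*-congˡ (invSpec 1)) (*-identityʳ S) ⟩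
    S ∎
    where
    open ≈-Reasoning
    J B i W q S : Carrier
    J = nat j
    B = binom half j
    i = inv (suc j)
    W = inv 4 ^ j
    q = inv 4
    S = sqrtCoefficient j

  x²+4⊛∂sqrtS : (x²+4 ⊛ ∂ sqrtS) ≋ (X ⊛ sqrtS)
  x²+4⊛∂sqrtS zero = begin
    (x²+4 ⊛ ∂ sqrtS) 0                            ≈⟨ x²+4⊛ (∂ sqrtS) 0 ⟩
    nat 4 * (nat 1 * 0#) + (X ⊛ (X ⊛ ∂ sqrtS)) 0  ≈⟨ +-cong (trans (*-congˡ (zeroʳ _)) (zeroʳ _)) (X⊛-zero (X ⊛ ∂ sqrtS)) ⟩
    0# + 0#                                       ≈⟨ trans (+-identityʳ 0#) (sym (X⊛-zero sqrtS)) ⟩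
    (X ⊛ sqrtS) 0                                 ∎
    where open ≈-Reasoning
  x²+4⊛∂sqrtS (suc m) = begin
    (x²+4 ⊛ ∂ sqrtS) (suc m)                                                  ≈⟨ x²+4⊛ (∂ sqrtS) (suc m) ⟩
    nat 4 * (nat (suc (suc m)) * sqrtS (suc (suc m))) + (X ⊛ (X ⊛ ∂ sqrtS)) (suc m) ≈⟨ +-congˡ (X⊛X⊛∂-suc sqrtS m) ⟩
    nat 4 * (nat (suc (suc m)) * sqrtS (suc (suc m))) + nat m * sqrtS m        ≈⟨ coefficient m (parity m) ⟩
    sqrtS m                                                                   ≈⟨ X⊛-suc sqrtS m ⟨
    (X ⊛ sqrtS) (suc m)                                                       ∎
    where
    open ≈-Reasoning
    coefficient : ∀ m → Parity m → nat 4 * (nat (suc (suc m)) * sqrtS (suc (suc m))) + nat m * sqrtS m ≈ sqrtS m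
    coefficient .(k ℕ.+ k) (even k) = begin
      nat 4 * (nat (suc (suc (k ℕ.+ k))) * evenPart (λ i → sqrtCoefficient (suc i)) (k ℕ.+ k)) + nat (k ℕ.+ k) * sqrtS (k ℕ.+ k)
        ≈⟨ +-cong (*-congˡ (*-congˡ (reflexive (evenPart-even _ k)))) (*-congˡ (reflexive (evenPart-even _ k))) ⟩
      nat 4 * (nat (suc (suc (k ℕ.+ k))) * sqrtCoefficient (suc k)) + nat (k ℕ.+ k) * sqrtCoefficient k
        ≈⟨ sqrtCoefficient-step k ⟩
      sqrtCoefficient k
        ≈⟨ reflexive (evenPart-even _ k) ⟨
      sqrtS (k ℕ.+ k) ∎
    coefficient .(suc (k ℕ.+ k)) (odd k) = begin
      nat 4 * (nat (suc (suc (suc (k ℕ.+ k)))) * evenPart (λ i → sqrtCoefficient (suc i)) (suc (k ℕ.+ k)))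
        + nat (suc (k ℕ.+ k)) * sqrtS (suc (k ℕ.+ k))
        ≈⟨ +-cong (*-congˡ (*-congˡ (reflexive (evenPart-odd _ k)))) (*-congˡ (reflexive (evenPart-odd _ k))) ⟩
      nat 4 * (nat (suc (suc (suc (k ℕ.+ k)))) * 0#) + nat (suc (k ℕ.+ k)) * 0#
        ≈⟨ solve 3 (λ a b c → a :* (b :* # 0) :+ c :* # 0 := # 0) refl (nat 4) _ _ ⟩
      0#
        ≈⟨ reflexive (evenPart-odd _ k) ⟨
      sqrtS (suc (k ℕ.+ k)) ∎

  sqrtS-at-0 : sqrtS 0 ≈ nat 2
  sqrtS-at-0 = solve 0 (# 2 :* ((# 1 :* # 1) :* # 1) := # 2) refl

  first-order-unique : ∀ a Y → Y 0 ≈ 0# → (x²+4 ⊛ ∂ Y) ≋ scale a (X ⊛ Y) → Y ≋ zeroS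
  first-order-unique a Y Y₀≈0 ode n = proj₁ (vanish n)
    where
    open ≈-Reasoning
    vanish : ∀ n → (Y n ≈ 0#) × (Y (suc n) ≈ 0#)
    vanish zero = Y₀≈0 , nat-*-zero 0 (nat-*-zero 3 (begin
      nat 4 * (nat 1 * Y 1)                       ≈⟨ trans (+-congˡ (X⊛-zero (X ⊛ ∂ Y))) (+-identityʳ _) ⟨
      nat 4 * (nat 1 * Y 1) + (X ⊛ (X ⊛ ∂ Y)) 0   ≈⟨ x²+4⊛ (∂ Y) 0 ⟨
      (x²+4 ⊛ ∂ Y) 0                              ≈⟨ ode 0 ⟩
      a * (X ⊛ Y) 0                               ≈⟨ trans (*-congˡ (X⊛-zero Y)) (zeroʳ a) ⟩
      0#                                          ∎))
    vanish (suc n) = proj₂ (vanish n) , nat-*-zero (suc n) (nat-*-zero 3 (begin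
      nat 4 * (nat (suc (suc n)) * Y (suc (suc n)))
        ≈⟨ trans (+-congˡ (trans (X⊛X⊛∂-suc Y n) (trans (*-congˡ (proj₁ (vanish n))) (zeroʳ _)))) (+-identityʳ _) ⟨
      nat 4 * (nat (suc (suc n)) * Y (suc (suc n))) + (X ⊛ (X ⊛ ∂ Y)) (suc n)
        ≈⟨ x²+4⊛ (∂ Y) (suc n) ⟨
      (x²+4 ⊛ ∂ Y) (suc n)
        ≈⟨ ode (suc n) ⟩
      a * (X ⊛ Y) (suc n)
        ≈⟨ trans (*-congˡ (trans (X⊛-suc Y n) (proj₁ (vanish n)))) (zeroʳ a) ⟩
      0# ∎))

  sqrtS⊛sqrtS : (sqrtS ⊛ sqrtS) ≋ x²+4
  sqrtS⊛sqrtS = begin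
    S ⊛ S        ≈⟨ SS.solve 2 (λ p q → p SS.:= (p SS.:- q) SS.:+ q) ≋-refl (S ⊛ S) x²+4 ⟩
    Y ⊕ x²+4     ≈⟨ ⊕-cong (first-order-unique (nat 2) Y Y₀≈0 ode) ≋-refl ⟩
    zeroS ⊕ x²+4 ≈⟨ (λ n → +-identityˡ _) ⟩
    x²+4         ∎
    where
    open ≋-Reasoning
    S Y : Series
    S = sqrtS
    Y = (S ⊛ S) ⊕ negS x²+4
    Y₀≈0 : Y 0 ≈ 0#
    Y₀≈0 = trans (+-cong (trans (⊛-zero S S) (*-cong sqrtS-at-0 sqrtS-at-0)) (-‿cong x²+4-at-0))
                 (solve 0 (# 2 :* # 2 :- # 4 := # 0) refl)
    -- (S² - (x²+4))′ (x²+4) = 2 S (x S) - 2 x (x²+4) = 2 x (S² - (x²+4))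
    ode : (x²+4 ⊛ ∂ Y) ≋ scale (nat 2) (X ⊛ Y)
    ode = begin
      x²+4 ⊛ ∂ Y
        ≈⟨ ⊛-congˡ x²+4 (≋-trans (∂-⊕ (S ⊛ S) (negS x²+4)) (⊕-cong (∂-⊛ S S) (≋-trans (∂-negS x²+4) (λ n → -‿cong (∂-x²+4 n))))) ⟩
      x²+4 ⊛ (((∂ S ⊛ S) ⊕ (S ⊛ ∂ S)) ⊕ negS (X ⊕ X))
        ≈⟨ SS.solve 4 (λ q ds s x → q SS.:* ((ds SS.:* s SS.:+ s SS.:* ds) SS.:+ SS.:- (x SS.:+ x))
                       SS.:= SS.# 2 SS.:* (s SS.:* (q SS.:* ds)) SS.:- SS.# 2 SS.:* (x SS.:* q)) ≋-refl x²+4 (∂ S) S X ⟩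
      (constS2 ⊛ (S ⊛ (x²+4 ⊛ ∂ S))) ⊕ negS (constS2 ⊛ (X ⊛ x²+4))
        ≈⟨ ⊕-cong (⊛-congˡ constS2 (⊛-congˡ S x²+4⊛∂sqrtS)) ≋-refl ⟩
      (constS2 ⊛ (S ⊛ (X ⊛ S))) ⊕ negS (constS2 ⊛ (X ⊛ x²+4))
        ≈⟨ SS.solve 4 (λ c s x q → c SS.:* (s SS.:* (x SS.:* s)) SS.:- c SS.:* (x SS.:* q) SS.:= c SS.:* (x SS.:* (s SS.:* s SS.:- q)))
                       ≋-refl constS2 S X x²+4 ⟩
      constS2 ⊛ (X ⊛ Y)
        ≈⟨ ≋-trans (scale≋constS⊛ (nat 2) (X ⊛ Y)) (⊛-congʳ (X ⊛ Y) (λ n → solve 1 (λ o → # 2 :* o := o :+ (o :+ # 0)) refl (oneS n))) ⟨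
      scale (nat 2) (X ⊛ Y) ∎
      where
      constS2 : Series
      constS2 = oneS ⊕ (oneS ⊕ zeroS)

  sqrtS⊛∂sqrtS : (sqrtS ⊛ ∂ sqrtS) ≋ X
  sqrtS⊛∂sqrtS = ⊛-cancelˡ x²+4 (inv 4) (trans (*-congʳ x²+4-at-0) (invSpec 3)) (begin
    x²+4 ⊛ (S ⊛ ∂ S)   ≈⟨ SS.solve 3 (λ q s d → q SS.:* (s SS.:* d) SS.:= s SS.:* (q SS.:* d)) ≋-refl x²+4 S (∂ S) ⟩
    S ⊛ (x²+4 ⊛ ∂ S)   ≈⟨ ⊛-congˡ S x²+4⊛∂sqrtS ⟩
    S ⊛ (X ⊛ S)        ≈⟨ SS.solve 2 (λ s x → s SS.:* (x SS.:* s) SS.:= (s SS.:* s) SS.:* x) ≋-refl S X ⟩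
    (S ⊛ S) ⊛ X        ≈⟨ ⊛-congʳ X sqrtS⊛sqrtS ⟩
    x²+4 ⊛ X           ∎)
    where
    open ≋-Reasoning
    S : Series
    S = sqrtS

module LogAlpha {c ℓ : Level} (R : CommutativeRing c ℓ) (inv : ℕ → CommutativeRing.Carrier R)
                (invSpec : PS.InvSpec R inv) where
  open CommutativeRing R
  open PS R inv
  open SeriesRing R inv
  open Calculus R inv invSpec
  open HyperbolicODE R inv invSpec
  open Coefficients R inv invSpec
  open SquareRoot R inv invSpec
  open CommutativeRingSolver R using (solve; _:=_; _:+_; _:*_; :-_; _:-_; #)

  sqrtS⊛∂α : (sqrtS ⊛ ∂ α) ≋ α
  sqrtS⊛∂α = begin
    S ⊛ ∂ α                   ≈⟨ ⊛-congˡ S ∂α ⟩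
    S ⊛ (H ⊛ (oneS ⊕ ∂ S))    ≈⟨ SS.solve 3 (λ s h d → s SS.:* (h SS.:* (SS.# 1 SS.:+ d)) SS.:= h SS.:* (s SS.:+ s SS.:* d)) ≋-refl S H (∂ S) ⟩
    H ⊛ (S ⊕ (S ⊛ ∂ S))       ≈⟨ ⊛-congˡ H (⊕-cong (≋-refl {S}) sqrtS⊛∂sqrtS) ⟩
    H ⊛ (S ⊕ X)               ≈⟨ ⊛-congˡ H (⊕-comm S X) ⟩
    H ⊛ (X ⊕ S)               ≈⟨ scale≋constS⊛ half (X ⊕ S) ⟨
    α                         ∎
    where
    open ≋-Reasoning
    S H : Series
    S = sqrtS
    H = constS half
    ∂α : ∂ α ≋ (H ⊛ (oneS ⊕ ∂ S))
    ∂α = ≋-trans (∂-scale half (X ⊕ S)) (≋-trans (scale≋constS⊛ half (∂ (X ⊕ S)))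
                 (⊛-congˡ H (≋-trans (∂-⊕ X S) (⊕-cong ∂-X ≋-refl))))

  α-at-0 : α 0 ≈ 1#
  α-at-0 = trans (*-congˡ (trans (+-identityˡ _) sqrtS-at-0)) (trans (*-comm _ _) (invSpec 1))

  alternatingS : Series
  alternatingS n = (- 1#) ^ n

  α-inverse : (α ⊛ comp alternatingS (α ⊖ oneS)) ≋ oneS
  α-inverse = begin
    α ⊛ comp G u                      ≈⟨ ⊛-congʳ (comp G u) (λ n → solve 2 (λ a o → a := o :+ (a :- o)) refl (α n) (oneS n)) ⟩
    (oneS ⊕ u) ⊛ comp G u             ≈⟨ SS.solve 2 (λ u p → (SS.# 1 SS.:+ u) SS.:* p SS.:= p SS.:+ u SS.:* p) ≋-refl u (comp G u) ⟩
    comp G u ⊕ (u ⊛ comp G u)         ≈⟨ ⊕-cong ≋-refl (comp-X⊛ G u u₀≈0) ⟨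
    comp G u ⊕ comp (X ⊛ G) u         ≈⟨ comp-⊕ G (X ⊛ G) u ⟨
    comp (G ⊕ (X ⊛ G)) u              ≈⟨ comp-cong u geometric ⟩
    comp oneS u                       ≈⟨ comp-oneS u ⟩
    oneS                              ∎
    where
    open ≋-Reasoning
    G u : Series
    G = alternatingS
    u = α ⊖ oneS
    u₀≈0 : u 0 ≈ 0#
    u₀≈0 = trans (+-congʳ α-at-0) (-‿inverseʳ 1#)
    geometric : (G ⊕ (X ⊛ G)) ≋ oneS
    geometric zero    = trans (+-congˡ (X⊛-zero G)) (+-identityʳ _)
    geometric (suc n) = trans (+-congˡ (X⊛-suc G n)) (solve 1 (λ g → g :* (:- # 1) :+ g := # 0) refl (G n))

  ∂-log1pS : ∂ log1pS ≋ alternatingS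
  ∂-log1pS n = trans (solve 3 (λ n g i → n :* (g :* i) := g :* (n :* i)) refl (nat (suc n)) (alternatingS n) (inv (suc n)))
                     (trans (*-congˡ (invSpec n)) (*-identityʳ _))

  sqrtS⊛∂logα : (sqrtS ⊛ ∂ logα) ≋ oneS
  sqrtS⊛∂logα = ⊛-cancelˡ α 1# (trans (*-identityʳ _) α-at-0) (begin
    α ⊛ (S ⊛ ∂ logα)           ≈⟨ ⊛-congˡ α (⊛-congˡ S ∂logα) ⟩
    α ⊛ (S ⊛ (P ⊛ ∂ α))        ≈⟨ SS.solve 4 (λ a s p d → a SS.:* (s SS.:* (p SS.:* d)) SS.:= (a SS.:* p) SS.:* (s SS.:* d)) ≋-refl α S P (∂ α) ⟩
    (α ⊛ P) ⊛ (S ⊛ ∂ α)        ≈⟨ ⊛-cong α-inverse sqrtS⊛∂α ⟩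
    oneS ⊛ α                   ≈⟨ ⊛-comm oneS α ⟩
    α ⊛ oneS                   ∎)
    where
    open ≋-Reasoning
    S P : Series
    S = sqrtS
    P = comp alternatingS (α ⊖ oneS)
    ∂logα : ∂ logα ≋ (P ⊛ ∂ α)
    ∂logα = ≋-trans (∂-comp log1pS (α ⊖ oneS) (trans (+-congʳ α-at-0) (-‿inverseʳ 1#)))
                    (⊛-cong {g = ∂ (α ⊖ oneS)} (comp-cong (α ⊖ oneS) ∂-log1pS) (λ n → *-congˡ (solve 1 (λ a → a :- # 0 := a) refl (α (suc n)))))

  logα-inverseSqrtDerivative : InverseSqrtDerivative logα
  logα-inverseSqrtDerivative = begin
    x²+4 ⊛ (∂ logα ⊛ ∂ logα)               ≈⟨ ⊛-congʳ (∂ logα ⊛ ∂ logα) sqrtS⊛sqrtS ⟨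
    (S ⊛ S) ⊛ (∂ logα ⊛ ∂ logα)            ≈⟨ SS.solve 2 (λ s l → (s SS.:* s) SS.:* (l SS.:* l) SS.:= (s SS.:* l) SS.:* (s SS.:* l)) ≋-refl S (∂ logα) ⟩
    (S ⊛ ∂ logα) ⊛ (S ⊛ ∂ logα)            ≈⟨ ⊛-cong sqrtS⊛∂logα sqrtS⊛∂logα ⟩
    oneS ⊛ oneS                            ≈⟨ oneS-⊛ oneS ⟩
    oneS                                   ∎
    where
    open ≋-Reasoning
    S : Series
    S = sqrtS

  logα-at-0 : logα 0 ≈ 0#
  logα-at-0 = comp-at-0 log1pS (α ⊖ oneS)

  logα-at-1 : logα 1 ≈ half
  logα-at-1 = trans (comp-at-1 log1pS (α ⊖ oneS) (trans (+-congʳ α-at-0) (-‿inverseʳ 1#)))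
    (trans (solve 2 (λ i h → (# 1 :* i) :* (h :* (# 1 :+ # 0) :- # 0) := i :* h) refl (inv 1) half)
           (trans (*-congʳ inv-1) (*-identityˡ half)))

module Dilation {c ℓ : Level} (R : CommutativeRing c ℓ) (inv : ℕ → CommutativeRing.Carrier R)
                (invSpec : PS.InvSpec R inv) where
  open CommutativeRing R
  open PS R inv
  open Sums R inv
  open SeriesRing R inv
  open Calculus R inv invSpec
  open CommutativeRingSolver R using (solve; _:=_; _:+_; _:*_; #)

  dilate : Carrier → Series → Series
  dilate a f n = f n * (a ^ n)

  ^-+ : ∀ a m k → a ^ (m ℕ.+ k) ≈ a ^ m * a ^ k
  ^-+ a m zero    = trans (reflexive (≡.cong (a ^_) (ℕ.+-identityʳ m))) (sym (*-identityʳ _))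
  ^-+ a m (suc k) = trans (reflexive (≡.cong (a ^_) (ℕ.+-suc m k)))
                          (trans (*-congʳ (^-+ a m k)) (*-assoc _ _ _))

  dilate-⊛ : ∀ a f g → dilate a (f ⊛ g) ≋ (dilate a f ⊛ dilate a g)
  dilate-⊛ a f g n = begin
    Σ< (suc n) (λ i → f i * g (n ∸ i)) * a ^ n
      ≈⟨ Σ<-*ʳ (suc n) (a ^ n) _ ⟨
    Σ< (suc n) (λ i → f i * g (n ∸ i) * a ^ n)
      ≈⟨ Σ<-cong (suc n) (λ i i<1+n → trans
           (*-congˡ (trans (reflexive (≡.cong (a ^_) (≡.sym (ℕ.m+[n∸m]≡n (ℕ.≤-pred i<1+n))))) (^-+ a i (n ∸ i))))
           (solve 4 (λ x y p q → x :* y :* (p :* q) := (x :* p) :* (y :* q)) refl _ _ _ _)) ⟩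
    (dilate a f ⊛ dilate a g) n ∎
    where open ≈-Reasoning

  dilate-⊕ : ∀ a f g → dilate a (f ⊕ g) ≋ (dilate a f ⊕ dilate a g)
  dilate-⊕ a f g n = distribʳ _ _ _

  dilate-cong : ∀ a {f g} → f ≋ g → dilate a f ≋ dilate a g
  dilate-cong a f≋g n = *-congʳ (f≋g n)

  dilate-oneS : ∀ a → dilate a oneS ≋ oneS
  dilate-oneS a zero    = *-identityʳ _
  dilate-oneS a (suc n) = zeroˡ _

  dilate-X : ∀ a → dilate a X ≋ (constS a ⊛ X)
  dilate-X a n = trans (dilate-X-scale n) (scale≋constS⊛ a X n)
    where
    dilate-X-scale : ∀ n → dilate a X n ≈ scale a X n
    dilate-X-scale zero          = trans (zeroˡ _) (sym (zeroʳ a))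
    dilate-X-scale (suc zero)    = solve 1 (λ a → # 1 :* (# 1 :* a) := a :* # 1) refl a
    dilate-X-scale (suc (suc n)) = trans (zeroˡ _) (sym (zeroʳ a))

  pow-scale-X : ∀ a m → pow (scale a X) m ≋ scale (a ^ m) (pow X m)
  pow-scale-X a zero    n = sym (*-identityˡ _)
  pow-scale-X a (suc m) = begin
    scale a X ⊛ pow (scale a X) m               ≈⟨ ⊛-cong (scale≋constS⊛ a X) (≋-trans (pow-scale-X a m) (scale≋constS⊛ (a ^ m) (pow X m))) ⟩
    (constS a ⊛ X) ⊛ (constS (a ^ m) ⊛ pow X m) ≈⟨ SS.solve 4 (λ A x B p → (A SS.:* x) SS.:* (B SS.:* p) SS.:= (B SS.:* A) SS.:* (x SS.:* p))
                                                               ≋-refl (constS a) X (constS (a ^ m)) (pow X m) ⟩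
    (constS (a ^ m) ⊛ constS a) ⊛ (X ⊛ pow X m) ≈⟨ ⊛-congʳ (X ⊛ pow X m) (constS-* (a ^ m) a) ⟨
    constS (a ^ m * a) ⊛ (X ⊛ pow X m)          ≈⟨ scale≋constS⊛ (a ^ m * a) (X ⊛ pow X m) ⟨
    scale (a ^ suc m) (pow X (suc m))           ∎
    where open ≋-Reasoning

  Σ<-pow-X : ∀ n (F : ℕ → Carrier) → Σ< (suc n) (λ m → F m * pow X m n) ≈ F n
  Σ<-pow-X zero    F = trans (+-identityˡ _) (*-identityʳ _)
  Σ<-pow-X (suc n) F = begin
    Σ< (suc (suc n)) (λ m → F m * pow X m (suc n))
      ≈⟨ Σ<-first (suc n) _ ⟩
    F 0 * 0# + Σ< (suc n) (λ m → F (suc m) * (X ⊛ pow X m) (suc n))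
      ≈⟨ +-cong (zeroʳ _) (Σ<-cong′ (suc n) (λ m → *-congˡ (X⊛-suc (pow X m) n))) ⟩
    0# + Σ< (suc n) (λ m → F (suc m) * pow X m n)
      ≈⟨ trans (+-identityˡ _) (Σ<-pow-X n (λ m → F (suc m))) ⟩
    F (suc n) ∎
    where open ≈-Reasoning

  comp-scale-X : ∀ f a → comp f (scale a X) ≋ dilate a f
  comp-scale-X f a n = begin
    Σ< (suc n) (λ m → f m * pow (scale a X) m n)
      ≈⟨ Σ<-cong′ (suc n) (λ m → trans (*-congˡ (pow-scale-X a m n)) (sym (*-assoc _ _ _))) ⟩
    Σ< (suc n) (λ m → (f m * a ^ m) * pow X m n)
      ≈⟨ Σ<-pow-X n (λ m → f m * a ^ m) ⟩
    f n * a ^ n ∎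
    where open ≈-Reasoning

module ArcSinh {c ℓ : Level} (R : CommutativeRing c ℓ) (inv : ℕ → CommutativeRing.Carrier R)
               (invSpec : PS.InvSpec R inv)
               (g : PS.Series R inv) (g₀≈0 : CommutativeRing._≈_ R (g 0) (CommutativeRing.0# R))
               (sinh∘g≋X : PS._≋_ R inv (PS.comp R inv (PS.sinhS R inv) g) (PS.X R inv)) where
  open CommutativeRing R
  open PS R inv
  open SeriesRing R inv
  open Calculus R inv invSpec
  open HyperbolicODE R inv invSpec
  open Coefficients R inv invSpec
  open Dilation R inv invSpec
  open CommutativeRingSolver R using (solve; _:=_; _:+_; _:*_; _:-_; #)

  cosh∘g sinh∘g : Series
  cosh∘g = comp coshS g
  sinh∘g = comp sinhS g

  ∂sinh∘g : ∂ sinh∘g ≋ (cosh∘g ⊛ ∂ g)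
  ∂sinh∘g = ≋-trans (∂-comp sinhS g g₀≈0) (⊛-congʳ (∂ g) (comp-cong g ∂-sinhS))

  ∂cosh∘g : ∂ cosh∘g ≋ (sinh∘g ⊛ ∂ g)
  ∂cosh∘g = ≋-trans (∂-comp coshS g g₀≈0) (⊛-congʳ (∂ g) (comp-cong g ∂-coshS))

  cosh²-sinh² : ((cosh∘g ⊛ cosh∘g) ⊕ negS (sinh∘g ⊛ sinh∘g)) ≋ oneS
  cosh²-sinh² = ∂-injective (begin
    ∂ ((C ⊛ C) ⊕ negS (S ⊛ S))
      ≈⟨ ≋-trans (∂-⊕ (C ⊛ C) (negS (S ⊛ S))) (⊕-cong (∂-⊛ C C) (≋-trans (∂-negS (S ⊛ S)) (λ n → -‿cong (∂-⊛ S S n)))) ⟩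
    ((∂ C ⊛ C) ⊕ (C ⊛ ∂ C)) ⊕ negS ((∂ S ⊛ S) ⊕ (S ⊛ ∂ S))
      ≈⟨ ⊕-cong (⊕-cong (⊛-congʳ C ∂cosh∘g) (⊛-congˡ C ∂cosh∘g))
                (λ n → -‿cong (⊕-cong (⊛-congʳ S ∂sinh∘g) (⊛-congˡ S ∂sinh∘g) n)) ⟩
    (((S ⊛ ∂ g) ⊛ C) ⊕ (C ⊛ (S ⊛ ∂ g))) ⊕ negS (((C ⊛ ∂ g) ⊛ S) ⊕ (S ⊛ (C ⊛ ∂ g)))
      ≈⟨ SS.solve 3 (λ s d c → ((s SS.:* d) SS.:* c SS.:+ c SS.:* (s SS.:* d)) SS.:+ SS.:- ((c SS.:* d) SS.:* s SS.:+ s SS.:* (c SS.:* d))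
                     SS.:= SS.# 0) ≋-refl S (∂ g) C ⟩
    zeroS
      ≈⟨ ∂-oneS ⟨
    ∂ oneS ∎)
    (trans (+-cong (trans (⊛-zero C C) (*-cong (comp-at-0 coshS g) (comp-at-0 coshS g)))
                   (-‿cong (trans (⊛-zero S S) (*-cong (comp-at-0 sinhS g) (comp-at-0 sinhS g)))))
           (solve 0 (# 1 :* # 1 :- # 0 :* # 0 := # 1) refl))
    where
    open ≋-Reasoning
    C S : Series
    C = cosh∘g
    S = sinh∘g

  [1+x²]∂g² : ((oneS ⊕ (X ⊛ X)) ⊛ (∂ g ⊛ ∂ g)) ≋ oneS
  [1+x²]∂g² = begin
    (oneS ⊕ (X ⊛ X)) ⊛ (∂ g ⊛ ∂ g)
      ≈⟨ ⊛-congʳ (∂ g ⊛ ∂ g) (≋-sym cosh²) ⟩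
    (C ⊛ C) ⊛ (∂ g ⊛ ∂ g)
      ≈⟨ SS.solve 2 (λ a d → (a SS.:* a) SS.:* (d SS.:* d) SS.:= (a SS.:* d) SS.:* (a SS.:* d)) ≋-refl C (∂ g) ⟩
    (C ⊛ ∂ g) ⊛ (C ⊛ ∂ g)
      ≈⟨ ⊛-cong C∂g≋1 C∂g≋1 ⟩
    oneS ⊛ oneS
      ≈⟨ oneS-⊛ oneS ⟩
    oneS ∎
    where
    open ≋-Reasoning
    C : Series
    C = cosh∘g
    cosh² : (C ⊛ C) ≋ (oneS ⊕ (X ⊛ X))
    cosh² = begin
      C ⊛ C                                         ≈⟨ SS.solve 2 (λ a b → a SS.:* a SS.:= (a SS.:* a SS.:- b SS.:* b) SS.:+ b SS.:* b) ≋-refl C sinh∘g ⟩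
      ((C ⊛ C) ⊕ negS (sinh∘g ⊛ sinh∘g)) ⊕ (sinh∘g ⊛ sinh∘g) ≈⟨ ⊕-cong cosh²-sinh² (⊛-cong sinh∘g≋X sinh∘g≋X) ⟩
      oneS ⊕ (X ⊛ X)                                ∎
    C∂g≋1 : (C ⊛ ∂ g) ≋ oneS
    C∂g≋1 = ≋-trans (≋-sym ∂sinh∘g) (≋-trans (∂-cong sinh∘g≋X) ∂-X)

  G : Series
  G = comp g (scale half X)

  G-at-0 : G 0 ≈ 0#
  G-at-0 = trans (comp-at-0 g (scale half X)) g₀≈0

  g-at-1 : g 1 ≈ 1#
  g-at-1 = begin
    g 1                  ≈⟨ *-identityˡ _ ⟨
    1# * g 1             ≈⟨ *-congʳ (trans (*-congˡ inv-1) (*-identityˡ 1#)) ⟨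
    sinhS 1 * g 1        ≈⟨ comp-at-1 sinhS g g₀≈0 ⟨
    sinh∘g 1             ≈⟨ sinh∘g≋X 1 ⟩
    1#                   ∎
    where open ≈-Reasoning

  G-at-1 : G 1 ≈ half
  G-at-1 = trans (comp-scale-X g half 1) (trans (*-cong g-at-1 (*-identityˡ half)) (*-identityˡ half))

  -- G(x) = g(x/2), so (x²+4) G′(x)² = (1 + (x/2)²) g′(x/2)².
  G-inverseSqrtDerivative : InverseSqrtDerivative G
  G-inverseSqrtDerivative = begin
    x²+4 ⊛ (∂ G ⊛ ∂ G)
      ≈⟨ ⊛-congˡ x²+4 (⊛-cong ∂G ∂G) ⟩
    (constS (nat 4) ⊕ (X ⊛ X)) ⊛ ((H ⊛ g′) ⊛ (H ⊛ g′))
      ≈⟨ SS.solve 4 (λ c x h s → (c SS.:+ x SS.:* x) SS.:* ((h SS.:* s) SS.:* (h SS.:* s))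
                     SS.:= (c SS.:* (h SS.:* h) SS.:+ (h SS.:* x) SS.:* (h SS.:* x)) SS.:* (s SS.:* s)) ≋-refl (constS (nat 4)) X H g′ ⟩
    ((constS (nat 4) ⊛ (H ⊛ H)) ⊕ ((H ⊛ X) ⊛ (H ⊛ X))) ⊛ (g′ ⊛ g′)
      ≈⟨ ⊛-congʳ (g′ ⊛ g′) (⊕-cong 4h²≋1 (≋-sym (⊛-cong (dilate-X half) (dilate-X half)))) ⟩
    (oneS ⊕ (dilate half X ⊛ dilate half X)) ⊛ (g′ ⊛ g′)
      ≈⟨ ⊛-congʳ (g′ ⊛ g′) (⊕-cong (dilate-oneS half) (dilate-⊛ half X X)) ⟨
    (dilate half oneS ⊕ dilate half (X ⊛ X)) ⊛ (g′ ⊛ g′)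
      ≈⟨ ⊛-cong (dilate-⊕ half oneS (X ⊛ X)) (dilate-⊛ half (∂ g) (∂ g)) ⟨
    dilate half (oneS ⊕ (X ⊛ X)) ⊛ dilate half (∂ g ⊛ ∂ g)
      ≈⟨ dilate-⊛ half (oneS ⊕ (X ⊛ X)) (∂ g ⊛ ∂ g) ⟨
    dilate half ((oneS ⊕ (X ⊛ X)) ⊛ (∂ g ⊛ ∂ g))
      ≈⟨ ≋-trans (dilate-cong half [1+x²]∂g²) (dilate-oneS half) ⟩
    oneS ∎
    where
    open ≋-Reasoning
    H g′ : Series
    H = constS half
    g′ = dilate half (∂ g)
    ∂G : ∂ G ≋ (H ⊛ g′)
    ∂G n = trans (*-congˡ (comp-scale-X g half (suc n)))
      (trans (solve 4 (λ N x p h → N :* (x :* (p :* h)) := h :* ((N :* x) :* p)) refl (nat (suc n)) (g (suc n)) (half ^ n) half)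
             (scale≋constS⊛ half g′ n))
    4h²≋1 : (constS (nat 4) ⊛ (H ⊛ H)) ≋ oneS
    4h²≋1 = ≋-trans (⊛-congˡ (constS (nat 4)) (≋-sym (constS-* half half)))
             (≋-trans (≋-sym (constS-* (nat 4) (half * half)))
               (≋-trans (constS-cong (trans (solve 1 (λ h → # 4 :* (h :* h) := (# 2 :* h) :* (# 2 :* h)) refl half)
                                        (trans (*-cong (invSpec 1) (invSpec 1)) (*-identityʳ 1#))))
                        constS-1#))

module Λ₁Identities {c ℓ : Level} (R : CommutativeRing c ℓ) (inv : ℕ → CommutativeRing.Carrier R)
                (invSpec : PS.InvSpec R inv) (t : CommutativeRing.Carrier R) where
  open CommutativeRing R
  open PS R inv
  open SeriesRing R inv
  open Calculus R inv invSpec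
  open HyperbolicODE R inv invSpec
  open Coefficients R inv invSpec
  open LambdaSeries R inv invSpec
  open LogAlpha R inv invSpec
  open CommutativeRingSolver R using (solve; _:=_; _:+_; _:*_; :-_; _:-_; #)

  Λ₁-unique : ∀ F → Recurrence (t * t) F → F 0 ≈ 0# → F 1 ≈ t → Λ₁ t ≋ F
  Λ₁-unique F recF F₀≈0 F₁≈t = recurrence-unique (Λ₁-recurrence t) recF (sym F₀≈0) (trans (Λ₁-at-1 t) (sym F₁≈t))

  comp-scale-at-1 : ∀ Φ G s → G 0 ≈ 0# → comp Φ (scale s G) 1 ≈ Φ 1 * (s * G 1)
  comp-scale-at-1 Φ G s G₀≈0 = comp-at-1 Φ (scale s G) (trans (*-congˡ G₀≈0) (zeroʳ s))

  invFact-1 : invFact 1 ≈ 1#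
  invFact-1 = trans (*-identityˡ _) inv-1

  t*[2*half]≈t : ∀ {a} → a ≈ t * (nat 2 * half) → a ≈ t
  t*[2*half]≈t a≈ = trans a≈ (trans (*-congˡ (invSpec 1)) (*-identityʳ t))

  Λ₁≋αpow-difference : Λ₁ t ≋ (αpow t ⊖ αpow (- t))
  Λ₁≋αpow-difference = Λ₁-unique _
    (recurrence-⊖ (αpow-recurrence t)
                  (recurrence-cong (solve 1 (λ t → (:- t) :* (:- t) := t :* t) refl t) (αpow-recurrence (- t))))
    (trans (+-cong (comp-at-0 expS (scale t logα)) (-‿cong (comp-at-0 expS (scale (- t) logα)))) (-‿inverseʳ _))
    (t*[2*half]≈t (begin
      αpow t 1 - αpow (- t) 1
        ≈⟨ +-cong (comp-scale-at-1 expS logα t logα-at-0) (-‿cong (comp-scale-at-1 expS logα (- t) logα-at-0)) ⟩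
      expS 1 * (t * logα 1) - expS 1 * (- t * logα 1)
        ≈⟨ +-cong (*-cong invFact-1 (*-congˡ logα-at-1)) (-‿cong (*-cong invFact-1 (*-congˡ logα-at-1))) ⟩
      1# * (t * half) - 1# * (- t * half)
        ≈⟨ solve 2 (λ t h → # 1 :* (t :* h) :- # 1 :* ((:- t) :* h) := t :* (# 2 :* h)) refl t half ⟩
      t * (nat 2 * half) ∎))
    where
    open ≈-Reasoning
    αpow-recurrence : ∀ s → Recurrence (s * s) (αpow s)
    αpow-recurrence s = ode⇒recurrence (s * s) (αpow s)
      (ode-comp expS logα s (≋-trans (∂-cong ∂-expS) ∂-expS) logα-at-0 logα-inverseSqrtDerivative)

  Λ₁≋2sinh : ∀ g → IsAsinh g → Λ₁ t ≋ scale (nat 2) (comp sinhS (scale t (comp g (scale half X))))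
  Λ₁≋2sinh g (g₀≈0 , sinh∘g≋X , _) = Λ₁-unique _
    (recurrence-scale (nat 2) (ode⇒recurrence (t * t) _
      (ode-comp sinhS G t (≋-trans (∂-cong ∂-sinhS) ∂-coshS) G-at-0 G-inverseSqrtDerivative)))
    (trans (*-congˡ (comp-at-0 sinhS (scale t G))) (zeroʳ _))
    (t*[2*half]≈t (begin
      nat 2 * comp sinhS (scale t G) 1      ≈⟨ *-congˡ (comp-scale-at-1 sinhS G t G-at-0) ⟩
      nat 2 * (sinhS 1 * (t * G 1))         ≈⟨ *-congˡ (*-cong invFact-1 (*-congˡ G-at-1)) ⟩
      nat 2 * (1# * (t * half))             ≈⟨ solve 2 (λ t h → # 2 :* (# 1 :* (t :* h)) := t :* (# 2 :* h)) refl t half ⟩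
      t * (nat 2 * half)                    ∎))
    where
    open ≈-Reasoning
    open ArcSinh R inv invSpec g g₀≈0 sinh∘g≋X

mainTheorem4 : ∀ {c ℓ : Level} (R : CommutativeRing c ℓ) (inv : ℕ → CommutativeRing.Carrier R) →
    let open CommutativeRing R in
    let open PS R inv in
    InvSpec →
    ∀ (t : Carrier) →
      (Λ₁ t ≋ (αpow t ⊖ αpow (- t)))
      × (∀ (g : Series) → IsAsinh g →
           Λ₁ t ≋ scale (nat 2) (comp sinhS (scale t (comp g (scale half X)))))
mainTheorem4 R inv invSpec t = Λ₁≋αpow-difference , Λ₁≋2sinh
  where open Λ₁Identities R inv invSpec t
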